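{- Let $n$ be a positive integer divisible by $3$. Then $$\mathscr{K}\left(B\left(1,\tfrac n3,\tfrac n3,\tfrac n3\right)\right)=\frac1{54}\left[n^3+3n^2+24n-36+\frac{ -513n^2+1782n-1701}{n^3+9n^2+9n-27}\right].$$
   Context: The barbell graph $B(1,a,b,c)$ on $a+b+c$ vertices is obtained from a path $P_a$ on $a$ vertices by joining every vertex of a complete graph $K_b$ to one endpoint of the path (forming a clique $K_{b+1}$) and every vertex of a complete graph $K_c$ to the other endpoint (forming a clique $K_{c+1}$). For a connected graph $H$ with $m\ge1$ edges and degrees $d_i$, Kemeny's constant is $\mathscr{K}(H)=\sum_j\pi_jm_{ij}$ for the simple random walk on $H$, where $\pi_j=d_j/2m$ and $m_{ij}$ is the expected hitting time of $j$ from $i$ ($m_{jj}=0$); equivalently $\mathscr{K}(H)=\frac1{4m}\sum_{i,j}d_id_jr_H(i,j)$ with $r_H$ the effective resistance. -}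

module Defs where

open import Data.Bool using (Bool; true; false; _∧_; _∨_; not; if_then_else_)
open import Data.Nat as ℕ using (ℕ; zero; suc; _≡ᵇ_; _<ᵇ_; _∸_)
open import Data.Fin using (Fin; toℕ)
import Data.Fin as Fin
open import Data.Integer using (ℤ; +_)
open import Data.Rational using (ℚ; 0ℚ; 1ℚ; _+_; _*_; _÷_; ≢-nonZero)
import Data.Rational as ℚ
open import Data.Rational.Properties using (_≟_)
open import Data.Product using (_×_; Σ)
open import Relation.Nullary using (yes; no; ¬_)
open import Relation.Binary.PropositionalEquality using (_≡_)

ℕ→ℚ : ℕ → ℚ
ℕ→ℚ k = (+ k) ℚ./ 1

-- total division on ℚ (x / 0 := 0); only ever applied to nonzero divisors here
_÷₀_ : ℚ → ℚ → ℚ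
p ÷₀ q with q ≟ 0ℚ
... | yes _ = 0ℚ
... | no q≢0 = _÷_ p q {{≢-nonZero q≢0}}

sumFin : (N : ℕ) → (Fin N → ℚ) → ℚ
sumFin zero    f = 0ℚ
sumFin (suc N) f = f Fin.zero + sumFin N (λ i → f (Fin.suc i))

-- Simple graphs on Fin N given by a (symmetric, irreflexive) adjacency function

Adj : ℕ → Set
Adj N = Fin N → Fin N → Bool

b2q : Bool → ℚ
b2q true  = 1ℚ
b2q false = 0ℚ

degree : {N : ℕ} → Adj N → Fin N → ℚ
degree {N} A i = sumFin N (λ k → b2q (A i k))

twiceEdges : {N : ℕ} → Adj N → ℚ
twiceEdges {N} A = sumFin N (degree A)

stationary : {N : ℕ} → Adj N → Fin N → ℚ
stationary A j = degree A j ÷₀ twiceEdges A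

transition : {N : ℕ} → Adj N → Fin N → Fin N → ℚ
transition A i k = b2q (A i k) ÷₀ degree A i

-- M is the matrix of expected hitting times m_ij of the simple random walk:
-- the (unique, for connected graphs) solution of the first-step equations
-- m_jj = 0 and m_ij = 1 + Σ_k p_ik m_kj for i ≠ j.
IsHittingTimes : {N : ℕ} → Adj N → (Fin N → Fin N → ℚ) → Set
IsHittingTimes {N} A M =
  ((j : Fin N) → M j j ≡ 0ℚ) ×
  ((i j : Fin N) → ¬ (i ≡ j) →
     M i j ≡ 1ℚ + sumFin N (λ k → transition A i k * M k j))

kemenyFrom : {N : ℕ} → Adj N → (Fin N → Fin N → ℚ) → Fin N → ℚ
kemenyFrom {N} A M i = sumFin N (λ j → stationary A j * M i j)

KemenyConstantIs : {N : ℕ} → Adj N → ℚ → Set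
KemenyConstantIs {N} A κ =
  Σ (Fin N → Fin N → ℚ) (IsHittingTimes A) ×
  ((M : Fin N → Fin N → ℚ) → IsHittingTimes A M → (i : Fin N) → kemenyFrom A M i ≡ κ)

-- Vertex numbering: 0..a-1 path P_a (in order), a..a+b-1 the clique K_b,
-- a+b..a+b+c-1 the clique K_c.

data Region : Set where
  P Kb Kc : Region

region : ℕ → ℕ → ℕ → Region
region a b i = if i <ᵇ a then P else (if i <ᵇ a ℕ.+ b then Kb else Kc)

link : ℕ → Region → Region → ℕ → ℕ → Bool
link a P  P  i j = (suc i ≡ᵇ j) ∨ (suc j ≡ᵇ i)
link a P  Kb i j = i ≡ᵇ 0
link a Kb P  i j = j ≡ᵇ 0
link a P  Kc i j = i ≡ᵇ (a ∸ 1)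
link a Kc P  i j = j ≡ᵇ (a ∸ 1)
link a Kb Kb i j = true
link a Kc Kc i j = true
link a Kb Kc i j = false
link a Kc Kb i j = false

barbell : (a b c : ℕ) → Adj (a ℕ.+ b ℕ.+ c)
barbell a b c x y =
  not (toℕ x ≡ᵇ toℕ y) ∧ link a (region a b (toℕ x)) (region a b (toℕ y)) (toℕ x) (toℕ y)

corollary3p5-rhs : ℕ → ℚ
corollary3p5-rhs n =
  (ℕ→ℚ 1 ÷₀ ℕ→ℚ 54) *
    ( (x * x * x + ℕ→ℚ 3 * x * x + ℕ→ℚ 24 * x ℚ.- ℕ→ℚ 36)
    + ((ℚ.- (ℕ→ℚ 513 * x * x) + ℕ→ℚ 1782 * x ℚ.- ℕ→ℚ 1701)
        ÷₀ (x * x * x + ℕ→ℚ 9 * x * x + ℕ→ℚ 9 * x ℚ.- ℕ→ℚ 27)))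
  where x = ℕ→ℚ n

-- The hitting times of a connected graph are the unique solution of the first-step equations:
-- the difference of two solutions is harmonic away from its target and vanishes there, so it
-- is zero by the maximum principle.  By Kac's formula (the return time to i is 2m / dᵢ) the
-- function i ↦ Σⱼ πⱼ mᵢⱼ is harmonic everywhere, hence constant: this is Kemeny's constant.
-- For B(1, s, s, s) the hitting times can be written down explicitly (constant on the cliques,
-- quadratic along the path); they are checked against the first-step and return equations
-- region by region, and Σⱼ dⱼ mᵢⱼ / 2m is evaluated from a clique vertex.  With n = 3s this
-- is the rational function of n in the statement.

module Submission where

open import Algebra.Bundles using (CommutativeRing)
open import Data.Bool using (Bool; true; false; not; _∧_; _∨_; if_then_else_)
open import Data.Fin as Fin using (Fin)
import Data.Fin.Properties as Fin
open import Data.List using (_∷_; []; allFin)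
open import Data.List.Membership.Propositional.Properties using (∈-allFin)
import Data.List.Relation.Unary.All as All
open import Data.Nat as ℕ using (ℕ; zero; suc; _<_; _/_; _≡ᵇ_; _<ᵇ_; _≤ᵇ_; _∸_; z≤n; s≤s)
open import Data.Nat.Divisibility using (_∣_; divides)
open import Data.Nat.DivMod using (m*n/n≡m)
import Data.Nat.Properties as ℕ
import Data.Bool.Properties as Bool
import Data.Nat.Coprimality as Coprime
import Data.Integer as ℤ
open import Data.Integer.Properties using (+◃n≡+n)
import Data.Rational.Unnormalised as ℚᵘ
import Data.Rational.Unnormalised.Properties as ℚᵘ
open import Data.Product using (Σ; _×_; _,_; proj₁; proj₂)
open import Data.Sum using (inj₁; inj₂)
open import Data.Rational as ℚ
  using (ℚ; 0ℚ; 1ℚ; _+_; _*_; _-_; -_; _≤_; 1/_; ≢-nonZero)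
import Data.Rational.Properties as ℚ
open import Function using (_∘_)
open import Level using (0ℓ)
open import Relation.Binary.PropositionalEquality
open import Relation.Nullary using (yes; no; contradiction)
open import Data.Empty using (⊥-elim)
open import Relation.Binary.Definitions using (tri<; tri≈; tri>)
open import Relation.Nullary.Decidable using (dec⇒maybe; dec-true; dec-false)
open import Tactic.RingSolver using (solve)
open import Tactic.RingSolver.Core.AlmostCommutativeRing
  using (AlmostCommutativeRing; fromCommutativeRing)

open import Algebra.Properties.Group ℚ.+-0-group using (x∙y⁻¹≈ε⇒x≈y; ⁻¹-involutive)
open import Algebra.Properties.CommutativeSemigroup
  (CommutativeRing.*-commutativeSemigroup ℚ.+-*-commutativeRing)
  using (x∙yz≈y∙xz; xy∙z≈xz∙y)
open import Algebra.Properties.Semiring.Sum (CommutativeRing.semiring ℚ.+-*-commutativeRing)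
  using (sum; sum-syntax; sum-cong-≗; ∑-distrib-+; ∑-comm; sum-replicate-zero; sum-remove;
         sum-init-last; *-distribˡ-sum; *-distribʳ-sum)
open import Relation.Binary.Bundles using (DecTotalOrder)
import Data.List.Extrema (DecTotalOrder.totalOrder ℚ.≤-decTotalOrder) as Extrema

open import Defs

ℚ-ring : AlmostCommutativeRing 0ℓ 0ℓ
ℚ-ring = fromCommutativeRing ℚ.+-*-commutativeRing (λ p → dec⇒maybe (0ℚ ℚ.≟ p))

-- The coefficients c used below are quotients of x - y by a - b, computed by polynomial division.
linear-combination : ∀ {x y a b : ℚ} → a ≡ b → (c : ℚ) → x - y ≡ c * (a - b) → x ≡ y
linear-combination {x} {y} {a} refl c x-y≡c[a-a] =
  x∙y⁻¹≈ε⇒x≈y x y (trans x-y≡c[a-a] (solve (c ∷ a ∷ []) ℚ-ring))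

÷₀-≢0 : ∀ p {q} (q≢0 : q ≢ 0ℚ) → p ÷₀ q ≡ p * (1/ q) {{≢-nonZero q≢0}}
÷₀-≢0 p {q} q≢0 with q ℚ.≟ 0ℚ
... | yes q≡0 = contradiction q≡0 q≢0
... | no _    = refl

*-÷₀-cancel : ∀ p {q} → q ≢ 0ℚ → q * (p ÷₀ q) ≡ p
*-÷₀-cancel p {q} q≢0 = begin
  q * (p ÷₀ q)    ≡⟨ cong (q *_) (÷₀-≢0 p q≢0) ⟩
  q * (p * 1/ q)  ≡⟨ x∙yz≈y∙xz q p (1/ q) ⟩
  p * (q * 1/ q)  ≡⟨ cong (p *_) (ℚ.*-inverseʳ q) ⟩
  p * 1ℚ          ≡⟨ ℚ.*-identityʳ p ⟩
  p               ∎
  where open ≡-Reasoning; instance _ = ≢-nonZero q≢0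

÷₀-*ʳ : ∀ p q r → (p ÷₀ q) * r ≡ (p * r) ÷₀ q
÷₀-*ʳ p q r with q ℚ.≟ 0ℚ
... | yes refl = ℚ.*-zeroˡ r
... | no q≢0   = xy∙z≈xz∙y p ((1/ q) {{≢-nonZero q≢0}}) r

÷₀-self : ∀ {p} → p ≢ 0ℚ → p ÷₀ p ≡ 1ℚ
÷₀-self {p} p≢0 = trans (÷₀-≢0 p p≢0) (ℚ.*-inverseʳ p {{≢-nonZero p≢0}})

÷₀-inverse : ∀ {q} → q ≢ 0ℚ → Σ ℚ (λ q⁻¹ → q * q⁻¹ ≡ 1ℚ × (∀ p → p ÷₀ q ≡ p * q⁻¹))
÷₀-inverse {q} q≢0 = 1/ q , ℚ.*-inverseʳ q , λ p → ÷₀-≢0 p q≢0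
  where instance _ = ≢-nonZero q≢0

p*q≡p+r⇒q≡1+r÷₀p : ∀ {p q r} → p ≢ 0ℚ → p * q ≡ p + r → q ≡ 1ℚ + r ÷₀ p
p*q≡p+r⇒q≡1+r÷₀p {p} {q} {r} p≢0 pq≡p+r with ÷₀-inverse p≢0
... | p⁻¹ , pp⁻¹≡1 , ÷₀p rewrite ÷₀p r =
  linear-combination pp⁻¹≡1 (1ℚ - q) (linear-combination pq≡p+r p⁻¹ (solve (p ∷ q ∷ r ∷ p⁻¹ ∷ []) ℚ-ring))

[q-p]÷₀p+1≡q÷₀p : ∀ {p} q → p ≢ 0ℚ → (q - p) ÷₀ p + 1ℚ ≡ q ÷₀ p
[q-p]÷₀p+1≡q÷₀p {p} q p≢0 with ÷₀-inverse p≢0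
... | p⁻¹ , pp⁻¹≡1 , ÷₀p rewrite ÷₀p (q - p) | ÷₀p q =
  linear-combination pp⁻¹≡1 (- 1ℚ) (solve (p ∷ q ∷ p⁻¹ ∷ []) ℚ-ring)

p÷₀q*q÷₀p≡1 : ∀ {p q} → p ≢ 0ℚ → q ≢ 0ℚ → (p ÷₀ q) * (q ÷₀ p) ≡ 1ℚ
p÷₀q*q÷₀p≡1 {p} {q} p≢0 q≢0 with ÷₀-inverse p≢0 | ÷₀-inverse q≢0
... | p⁻¹ , pp⁻¹≡1 , ÷₀p | q⁻¹ , qq⁻¹≡1 , ÷₀q rewrite ÷₀p q | ÷₀q p =
  linear-combination qq⁻¹≡1 (p * p⁻¹) (linear-combination pp⁻¹≡1 1ℚ (solve (p ∷ q ∷ p⁻¹ ∷ q⁻¹ ∷ []) ℚ-ring))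

÷₀-*-cancel : ∀ p {q} → q ≢ 0ℚ → (p ÷₀ q) * q ≡ p
÷₀-*-cancel p {q} q≢0 = trans (ℚ.*-comm (p ÷₀ q) q) (*-÷₀-cancel p q≢0)

*-≢0 : ∀ {p q} → p ≢ 0ℚ → q ≢ 0ℚ → p * q ≢ 0ℚ
*-≢0 {p} {q} p≢0 q≢0 pq≡0 with ÷₀-inverse p≢0 | ÷₀-inverse q≢0
... | p⁻¹ , pp⁻¹≡1 , _ | q⁻¹ , qq⁻¹≡1 , _ = 1≢0
  (linear-combination pq≡0 (p⁻¹ * q⁻¹) (linear-combination pp⁻¹≡1 (- (q * q⁻¹))
    (linear-combination qq⁻¹≡1 (- 1ℚ) (solve (p ∷ q ∷ p⁻¹ ∷ q⁻¹ ∷ []) ℚ-ring))))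
  where
  1≢0 : 1ℚ ≢ 0ℚ
  1≢0 ()

÷₀-rearrange : ∀ {t w c p q d} → w ≢ 0ℚ → c ≢ 0ℚ → d ≢ 0ℚ → t * (c * d) ≡ (p * d + q) * w →
               t ÷₀ w ≡ (1ℚ ÷₀ c) * (p + q ÷₀ d)
÷₀-rearrange {t} {w} {c} {p} {q} {d} w≢0 c≢0 d≢0 t[cd]≡[pd+q]w
  with ÷₀-inverse w≢0 | ÷₀-inverse c≢0 | ÷₀-inverse d≢0
... | w⁻¹ , ww⁻¹≡1 , ÷₀w | c⁻¹ , cc⁻¹≡1 , ÷₀c | d⁻¹ , dd⁻¹≡1 , ÷₀d rewrite ÷₀w t | ÷₀c 1ℚ | ÷₀d q =
  linear-combination t[cd]≡[pd+q]w (c⁻¹ * d⁻¹ * w⁻¹)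
    (linear-combination cc⁻¹≡1 (- (t * w⁻¹))
      (linear-combination dd⁻¹≡1 (c⁻¹ * p - t * w⁻¹ * (c * c⁻¹))
        (linear-combination ww⁻¹≡1 (c⁻¹ * p * (d * d⁻¹) + c⁻¹ * q * d⁻¹)
          (solve (t ∷ w ∷ c ∷ p ∷ q ∷ d ∷ w⁻¹ ∷ c⁻¹ ∷ d⁻¹ ∷ []) ℚ-ring))))

sumFin≡∑ : ∀ n (f : Fin n → ℚ) → sumFin n f ≡ ∑[ k < n ] f k
sumFin≡∑ zero    f = refl
sumFin≡∑ (suc n) f = cong (f Fin.zero +_) (sumFin≡∑ n (f ∘ Fin.suc))

∑-neg : ∀ {n} (f : Fin n → ℚ) → ∑[ k < n ] (- f k) ≡ - (∑[ k < n ] f k)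
∑-neg {zero}  f = refl
∑-neg {suc n} f = trans (cong (- f Fin.zero +_) (∑-neg (f ∘ Fin.suc)))
                        (sym (ℚ.neg-distrib-+ (f Fin.zero) _))

∑-distrib-- : ∀ {n} (f g : Fin n → ℚ) → ∑[ k < n ] (f k - g k) ≡ ∑[ k < n ] f k - ∑[ k < n ] g k
∑-distrib-- f g = trans (∑-distrib-+ f (-_ ∘ g)) (cong (sum f +_) (∑-neg g))

∑-÷₀ : ∀ {n} (f : Fin n → ℚ) q → ∑[ k < n ] (f k ÷₀ q) ≡ (∑[ k < n ] f k) ÷₀ q
∑-÷₀ {n} f q with q ℚ.≟ 0ℚ
... | yes refl = sum-replicate-zero n
... | no q≢0   = sym (*-distribʳ-sum ((1/ q) {{≢-nonZero q≢0}}) f)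

∑-delta : ∀ {n} (f : Fin n → ℚ) i → (∀ k → k ≢ i → f k ≡ 0ℚ) → ∑[ k < n ] f k ≡ f i
∑-delta {suc n} f i off-i = begin
  sum f                          ≡⟨ sum-remove f ⟩
  f i + ∑[ k < n ] f (Fin.punchIn i k)  ≡⟨ cong (f i +_) (sum-cong-≗ (λ k → off-i _ (Fin.punchInᵢ≢i i k))) ⟩
  f i + ∑[ k < n ] 0ℚ            ≡⟨ cong (f i +_) (sum-replicate-zero n) ⟩
  f i + 0ℚ                       ≡⟨ ℚ.+-identityʳ (f i) ⟩
  f i                            ∎
  where open ≡-Reasoning

p-q≡r⇒p≡q+r : ∀ {p q r} → p - q ≡ r → p ≡ q + r
p-q≡r⇒p≡q+r {p} {q} {r} p-q≡r = linear-combination p-q≡r 1ℚ (solve (p ∷ q ∷ r ∷ []) ℚ-ring)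

p+q≡r⇒q≡r-p : ∀ {p q r} → p + q ≡ r → q ≡ r - p
p+q≡r⇒q≡r-p {p} {q} {r} p+q≡r = linear-combination p+q≡r 1ℚ (solve (p ∷ q ∷ r ∷ []) ℚ-ring)

∑-update : ∀ {n} (f g : Fin n → ℚ) i → (∀ k → k ≢ i → f k ≡ g k) →
           ∑[ k < n ] f k ≡ ∑[ k < n ] g k + (f i - g i)
∑-update f g i agree = p-q≡r⇒p≡q+r (trans (sym (∑-distrib-- f g))
  (∑-delta (λ k → f k - g k) i (λ k k≢i → trans (cong (_- g k) (agree k k≢i)) (ℚ.+-inverseʳ (g k)))))

∑-nonneg : ∀ {n} (f : Fin n → ℚ) → (∀ k → 0ℚ ≤ f k) → 0ℚ ≤ ∑[ k < n ] f k
∑-nonneg {zero}  f 0≤f = ℚ.≤-refl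
∑-nonneg {suc n} f 0≤f = ℚ.+-mono-≤ (0≤f Fin.zero) (∑-nonneg (f ∘ Fin.suc) (0≤f ∘ Fin.suc))

nonneg-∑≡0 : ∀ {n} (f : Fin n → ℚ) → (∀ k → 0ℚ ≤ f k) → ∑[ k < n ] f k ≡ 0ℚ → ∀ i → f i ≡ 0ℚ
nonneg-∑≡0 {suc n} f 0≤f ∑f≡0 i = ℚ.≤-antisym fi≤0 (0≤f i)
  where
  fi≤0 : f i ≤ 0ℚ
  fi≤0 = begin
    f i                                   ≡⟨ ℚ.+-identityʳ (f i) ⟨
    f i + 0ℚ                              ≤⟨ ℚ.+-monoʳ-≤ (f i) (∑-nonneg _ (λ k → 0≤f (Fin.punchIn i k))) ⟩
    f i + ∑[ k < n ] f (Fin.punchIn i k)  ≡⟨ trans (sym (sum-remove f)) ∑f≡0 ⟩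
    0ℚ                                    ∎
    where open ℚ.≤-Reasoning

argmax : ∀ {n} (f : Fin n → ℚ) → Fin n → Σ (Fin n) (λ m → ∀ k → f k ≤ f m)
argmax {n} f i = m , λ k → All.lookup (Extrema.f[xs]≤f[argmax] i (allFin n)) (∈-allFin k)
  where m = Extrema.argmax f i (allFin n)

b2q-nonneg : ∀ b → 0ℚ ≤ b2q b
b2q-nonneg true  = ℚ.nonNegative⁻¹ 1ℚ
b2q-nonneg false = ℚ.≤-refl

b2q*-nonneg : ∀ {x} b → 0ℚ ≤ x → 0ℚ ≤ b2q b * x
b2q*-nonneg {x} true  0≤x = subst (0ℚ ≤_) (sym (ℚ.*-identityˡ x)) 0≤x
b2q*-nonneg {x} false _   = subst (0ℚ ≤_) (sym (ℚ.*-zeroˡ x)) ℚ.≤-refl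

p≤q⇒0≤q-p : ∀ {p q} → p ≤ q → 0ℚ ≤ q - p
p≤q⇒0≤q-p {p} {q} p≤q = subst (_≤ q - p) (ℚ.+-inverseʳ p) (ℚ.+-monoˡ-≤ (- p) p≤q)

*-distribˡ-- : ∀ a p q → a * (p - q) ≡ a * p - a * q
*-distribˡ-- a p q = solve (a ∷ p ∷ q ∷ []) ℚ-ring

1+p*1-1≡p : ∀ p → 1ℚ + p * 1ℚ - 1ℚ ≡ p
1+p*1-1≡p p = solve (p ∷ []) ℚ-ring

-- Simple random walk on a finite graph

module RandomWalk {N : ℕ} (A : Adj N) where

  neighbourSum : Fin N → (Fin N → ℚ) → ℚ
  neighbourSum i f = ∑[ k < N ] (b2q (A i k) * f k)

  Harmonic : (Fin N → ℚ) → Fin N → Set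
  Harmonic f i = f i ≡ ∑[ k < N ] (transition A i k * f k)

  infixr 5 _∷_
  data Walk : Fin N → Fin N → Set where
    []  : ∀ {u} → Walk u u
    _∷_ : ∀ {u v w} → A u v ≡ true → Walk v w → Walk u w

  infixr 5 _++_
  _++_ : ∀ {u v w} → Walk u v → Walk v w → Walk u w
  []          ++ walk′ = walk′
  (Auv ∷ walk) ++ walk′ = Auv ∷ (walk ++ walk′)

  Connected : Set
  Connected = ∀ u v → Walk u v

  -- Kac's formula: the expected return time 1 + Σₖ pᵢₖ mₖᵢ to i is 2m / dᵢ.
  ReturnTimes : (Fin N → Fin N → ℚ) → Set
  ReturnTimes M = ∀ i → degree A i + neighbourSum i (λ k → M k i) ≡ twiceEdges A

  degree≡∑ : ∀ i → degree A i ≡ ∑[ k < N ] b2q (A i k)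
  degree≡∑ i = sumFin≡∑ N _

  degree≢0 : ∀ {u v} → A u v ≡ true → degree A u ≢ 0ℚ
  degree≢0 {u} {v} Auv d≡0 = 1≢0 (subst (λ b → b2q b ≡ 0ℚ) Auv
    (nonneg-∑≡0 (b2q ∘ A u) (b2q-nonneg ∘ A u) (trans (sym (degree≡∑ u)) d≡0) v))
    where
    1≢0 : 1ℚ ≢ 0ℚ
    1≢0 ()

  nonempty-walk⇒degree≢0 : ∀ {i j} → Walk i j → i ≢ j → degree A i ≢ 0ℚ
  nonempty-walk⇒degree≢0 []          i≢i = contradiction refl i≢i
  nonempty-walk⇒degree≢0 (Aiv ∷ _) _   = degree≢0 Aiv

  connected⇒degree≢0 : Connected → ∀ {a b} → a ≢ b → ∀ i → degree A i ≢ 0ℚ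
  connected⇒degree≢0 conn {a} {b} a≢b i with i Fin.≟ a
  ... | yes refl = nonempty-walk⇒degree≢0 (conn i b) a≢b
  ... | no i≢a   = nonempty-walk⇒degree≢0 (conn i a) i≢a

  transition-average : ∀ i f → ∑[ k < N ] (transition A i k * f k) ≡ neighbourSum i f ÷₀ degree A i
  transition-average i f =
    trans (sum-cong-≗ (λ k → ÷₀-*ʳ (b2q (A i k)) (degree A i) (f k))) (∑-÷₀ (λ k → b2q (A i k) * f k) (degree A i))

  transition-rowSum : ∀ i → degree A i ≢ 0ℚ → ∑[ k < N ] transition A i k ≡ 1ℚ
  transition-rowSum i dᵢ≢0 = begin
    ∑[ k < N ] (b2q (A i k) ÷₀ degree A i)  ≡⟨ ∑-÷₀ (b2q ∘ A i) (degree A i) ⟩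
    (∑[ k < N ] b2q (A i k)) ÷₀ degree A i  ≡⟨ cong (_÷₀ degree A i) (degree≡∑ i) ⟨
    degree A i ÷₀ degree A i                ≡⟨ ÷₀-self dᵢ≢0 ⟩
    1ℚ                                      ∎
    where open ≡-Reasoning

  harmonic⇒mean : ∀ {f u v} → A u v ≡ true → Harmonic f u → degree A u * f u ≡ neighbourSum u f
  harmonic⇒mean {f} {u} Auv harm =
    trans (cong (degree A u *_) (trans harm (transition-average u f))) (*-÷₀-cancel _ (degree≢0 Auv))

  -- Σₖ [u ~ k] (f u - f k) = 0 is a sum of nonnegative terms when f u is maximal.
  harmonic-max-spreads : ∀ {f u v} → Harmonic f u → (∀ k → f k ≤ f u) → A u v ≡ true → f v ≡ f u
  harmonic-max-spreads {f} {u} {v} harm u-max Auv =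
    sym (x∙y⁻¹≈ε⇒x≈y (f u) (f v) (trans (sym (ℚ.*-identityˡ _)) gapᵥ≡0))
    where
    gap : Fin N → ℚ
    gap k = b2q (A u k) * (f u - f k)
    ∑gap≡0 : ∑[ k < N ] gap k ≡ 0ℚ
    ∑gap≡0 = begin
      ∑[ k < N ] gap k                                            ≡⟨ sum-cong-≗ (λ k → *-distribˡ-- (b2q (A u k)) (f u) (f k)) ⟩
      ∑[ k < N ] (b2q (A u k) * f u - b2q (A u k) * f k)          ≡⟨ ∑-distrib-- (λ k → b2q (A u k) * f u) (λ k → b2q (A u k) * f k) ⟩
      ∑[ k < N ] (b2q (A u k) * f u) - neighbourSum u f           ≡⟨ cong (_- neighbourSum u f) (*-distribʳ-sum (f u) (b2q ∘ A u)) ⟨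
      (∑[ k < N ] b2q (A u k)) * f u - neighbourSum u f           ≡⟨ cong (λ d → d * f u - neighbourSum u f) (degree≡∑ u) ⟨
      degree A u * f u - neighbourSum u f                         ≡⟨ cong (_- neighbourSum u f) (harmonic⇒mean Auv harm) ⟩
      neighbourSum u f - neighbourSum u f                         ≡⟨ ℚ.+-inverseʳ (neighbourSum u f) ⟩
      0ℚ                                                          ∎
      where open ≡-Reasoning
    gapᵥ≡0 : b2q true * (f u - f v) ≡ 0ℚ
    gapᵥ≡0 = subst (λ b → b2q b * (f u - f v) ≡ 0ℚ) Auv
      (nonneg-∑≡0 gap (λ k → b2q*-nonneg (A u k) (p≤q⇒0≤q-p (u-max k))) ∑gap≡0 v)

  harmonic-max-at-boundary : Connected → ∀ {f j} → (∀ i → i ≢ j → Harmonic f i) → ∀ i → f i ≤ f j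
  harmonic-max-at-boundary conn {f} {j} harm i = subst (f i ≤_) (sym (reach (conn m j) refl)) (m-max i)
    where
    m = proj₁ (argmax f i)
    m-max = proj₂ (argmax f i)
    reach : ∀ {u} → Walk u j → f u ≡ f m → f j ≡ f m
    reach []                fu≡fm = fu≡fm
    reach {u} (Auv ∷ walk) fu≡fm with u Fin.≟ j
    ... | yes refl = fu≡fm
    ... | no u≢j   = reach walk (trans (harmonic-max-spreads (harm u u≢j) u-max Auv) fu≡fm)
      where
      u-max : ∀ k → f k ≤ f u
      u-max k = subst (f k ≤_) (sym fu≡fm) (m-max k)

  harmonic-neg : ∀ {f i} → Harmonic f i → Harmonic (-_ ∘ f) i
  harmonic-neg {f} {i} harm = begin
    - f i                                         ≡⟨ cong -_ harm ⟩
    - (∑[ k < N ] (transition A i k * f k))       ≡⟨ ∑-neg (λ k → transition A i k * f k) ⟨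
    ∑[ k < N ] (- (transition A i k * f k))       ≡⟨ sum-cong-≗ (λ k → ℚ.neg-distribʳ-* (transition A i k) (f k)) ⟩
    ∑[ k < N ] (transition A i k * - f k)         ∎
    where open ≡-Reasoning

  harmonic-vanishes : Connected → ∀ {f j} → f j ≡ 0ℚ → (∀ i → i ≢ j → Harmonic f i) → ∀ i → f i ≡ 0ℚ
  harmonic-vanishes conn {f} {j} fⱼ≡0 harm i = ℚ.≤-antisym fᵢ≤0 0≤fᵢ
    where
    fᵢ≤0 : f i ≤ 0ℚ
    fᵢ≤0 = subst (f i ≤_) fⱼ≡0 (harmonic-max-at-boundary conn harm i)
    -fᵢ≤0 : - f i ≤ 0ℚ
    -fᵢ≤0 = subst (- f i ≤_) (cong -_ fⱼ≡0)
              (harmonic-max-at-boundary conn (λ k k≢j → harmonic-neg (harm k k≢j)) i)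
    0≤fᵢ : 0ℚ ≤ f i
    0≤fᵢ = subst (0ℚ ≤_) (⁻¹-involutive (f i)) (ℚ.neg-antimono-≤ -fᵢ≤0)

  first-step : ∀ {M} → IsHittingTimes A M → ∀ {i j} → i ≢ j →
               M i j ≡ 1ℚ + ∑[ k < N ] (transition A i k * M k j)
  first-step (_ , step) {i} {j} i≢j = trans (step i j i≢j) (cong (1ℚ +_) (sumFin≡∑ N _))

  hittingTimes-unique : Connected → ∀ {M M'} → IsHittingTimes A M → IsHittingTimes A M' →
                        ∀ i j → M i j ≡ M' i j
  hittingTimes-unique conn {M} {M'} hM hM' i j =
    x∙y⁻¹≈ε⇒x≈y _ _ (harmonic-vanishes conn Dⱼ≡0 D-harmonic i)
    where
    D : Fin N → ℚ
    D k = M k j - M' k j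
    Dⱼ≡0 : D j ≡ 0ℚ
    Dⱼ≡0 = cong₂ _-_ (proj₁ hM j) (proj₁ hM' j)
    D-harmonic : ∀ i → i ≢ j → Harmonic D i
    D-harmonic i i≢j = begin
      M i j - M' i j
        ≡⟨ cong₂ _-_ (first-step hM i≢j) (first-step hM' i≢j) ⟩
      (1ℚ + ∑[ k < N ] pM k) - (1ℚ + ∑[ k < N ] pM′ k)
        ≡⟨ 1+p-[1+q]≡p-q (∑[ k < N ] pM k) (∑[ k < N ] pM′ k) ⟩
      ∑[ k < N ] pM k - ∑[ k < N ] pM′ k
        ≡⟨ ∑-distrib-- pM pM′ ⟨
      ∑[ k < N ] (pM k - pM′ k)
        ≡⟨ sum-cong-≗ (λ k → *-distribˡ-- (transition A i k) (M k j) (M' k j)) ⟨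
      ∑[ k < N ] (transition A i k * D k)
        ∎
      where
      open ≡-Reasoning
      pM pM′ : Fin N → ℚ
      pM  k = transition A i k * M k j
      pM′ k = transition A i k * M' k j
      1+p-[1+q]≡p-q : ∀ p q → (1ℚ + p) - (1ℚ + q) ≡ p - q
      1+p-[1+q]≡p-q p q = solve (p ∷ q ∷ []) ℚ-ring

  stationary-sum : twiceEdges A ≢ 0ℚ → ∑[ j < N ] stationary A j ≡ 1ℚ
  stationary-sum 2m≢0 = begin
    ∑[ j < N ] (degree A j ÷₀ twiceEdges A)   ≡⟨ ∑-÷₀ (degree A) (twiceEdges A) ⟩
    (∑[ j < N ] degree A j) ÷₀ twiceEdges A   ≡⟨ cong (_÷₀ twiceEdges A) (sumFin≡∑ N (degree A)) ⟨
    twiceEdges A ÷₀ twiceEdges A              ≡⟨ ÷₀-self 2m≢0 ⟩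
    1ℚ                                        ∎
    where open ≡-Reasoning

  module _ (deg≢0 : ∀ i → degree A i ≢ 0ℚ) (2m≢0 : twiceEdges A ≢ 0ℚ)
           {M : Fin N → Fin N → ℚ} (hM : IsHittingTimes A M) (return : ReturnTimes M) where

    private
      π = stationary A
      p = transition A
      v = kemenyFrom A M

    stationary*returnTime≡1 : ∀ i → π i * (∑[ k < N ] (p i k * M k i) + 1ℚ) ≡ 1ℚ
    stationary*returnTime≡1 i = begin
      π i * (∑[ k < N ] (p i k * M k i) + 1ℚ)                       ≡⟨ cong (λ x → π i * (x + 1ℚ)) (transition-average i (λ k → M k i)) ⟩
      π i * (neighbourSum i (λ k → M k i) ÷₀ degree A i + 1ℚ)       ≡⟨ cong (λ x → π i * (x ÷₀ degree A i + 1ℚ)) Sᵢ≡2m-dᵢ ⟩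
      π i * ((twiceEdges A - degree A i) ÷₀ degree A i + 1ℚ)        ≡⟨ cong (π i *_) ([q-p]÷₀p+1≡q÷₀p (twiceEdges A) (deg≢0 i)) ⟩
      (degree A i ÷₀ twiceEdges A) * (twiceEdges A ÷₀ degree A i)   ≡⟨ p÷₀q*q÷₀p≡1 (deg≢0 i) 2m≢0 ⟩
      1ℚ                                                            ∎
      where
      open ≡-Reasoning
      Sᵢ≡2m-dᵢ : neighbourSum i (λ k → M k i) ≡ twiceEdges A - degree A i
      Sᵢ≡2m-dᵢ = p+q≡r⇒q≡r-p (return i)

    -- Σₖ pᵢₖ mₖⱼ = mᵢⱼ - 1 for j ≢ i, and the j = i term contributes πᵢ (Σₖ pᵢₖ mₖᵢ + 1) = 1.
    kemenyFrom-harmonic : ∀ i → Harmonic v i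
    kemenyFrom-harmonic i = sym (begin
      ∑[ k < N ] (p i k * v k)                               ≡⟨ sum-cong-≗ (λ k → cong (p i k *_) (sumFin≡∑ N _)) ⟩
      ∑[ k < N ] (p i k * ∑[ j < N ] (π j * M k j))          ≡⟨ sum-cong-≗ (λ k → *-distribˡ-sum (p i k) (λ j → π j * M k j)) ⟩
      ∑[ k < N ] ∑[ j < N ] (p i k * (π j * M k j))          ≡⟨ ∑-comm (λ k j → p i k * (π j * M k j)) ⟩
      ∑[ j < N ] ∑[ k < N ] (p i k * (π j * M k j))          ≡⟨ sum-cong-≗ (λ j → trans (sum-cong-≗ (λ k → x∙yz≈y∙xz (p i k) (π j) (M k j)))
                                                                                          (sym (*-distribˡ-sum (π j) (λ k → p i k * M k j)))) ⟩
      ∑[ j < N ] (π j * step j)                              ≡⟨ ∑-update (λ j → π j * step j) (λ j → π j * (M i j - 1ℚ)) i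
                                                                  (λ j j≢i → cong (π j *_) (step-off-diagonal j≢i)) ⟩
      ∑[ j < N ] (π j * (M i j - 1ℚ)) + (π i * step i - π i * (M i i - 1ℚ))
                                                             ≡⟨ cong₂ _+_ ∑π[M-1]≡v-1 diagonal-term ⟩
      (v i - 1ℚ) + 1ℚ                                        ≡⟨ p-1+1≡p (v i) ⟩
      v i                                                    ∎)
      where
      open ≡-Reasoning
      step : Fin N → ℚ
      step j = ∑[ k < N ] (p i k * M k j)
      step-off-diagonal : ∀ {j} → j ≢ i → step j ≡ M i j - 1ℚ
      step-off-diagonal {j} j≢i = p≡1+q⇒q≡p-1 (first-step hM (j≢i ∘ sym))
        where
        p≡1+q⇒q≡p-1 : ∀ {a b} → a ≡ 1ℚ + b → b ≡ a - 1ℚ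
        p≡1+q⇒q≡p-1 {a} {b} a≡1+b = linear-combination a≡1+b (- 1ℚ) (solve (a ∷ b ∷ []) ℚ-ring)
      ∑π[M-1]≡v-1 : ∑[ j < N ] (π j * (M i j - 1ℚ)) ≡ v i - 1ℚ
      ∑π[M-1]≡v-1 = begin
        ∑[ j < N ] (π j * (M i j - 1ℚ))                   ≡⟨ sum-cong-≗ (λ j → *-distribˡ-- (π j) (M i j) 1ℚ) ⟩
        ∑[ j < N ] (π j * M i j - π j * 1ℚ)               ≡⟨ ∑-distrib-- (λ j → π j * M i j) (λ j → π j * 1ℚ) ⟩
        ∑[ j < N ] (π j * M i j) - ∑[ j < N ] (π j * 1ℚ)  ≡⟨ cong₂ _-_ (sumFin≡∑ N _) (sum-cong-≗ (λ j → sym (ℚ.*-identityʳ (π j)))) ⟨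
        v i - ∑[ j < N ] π j                              ≡⟨ cong (λ x → v i - x) (stationary-sum 2m≢0) ⟩
        v i - 1ℚ                                          ∎
      diagonal-term : π i * step i - π i * (M i i - 1ℚ) ≡ 1ℚ
      diagonal-term = begin
        π i * step i - π i * (M i i - 1ℚ)   ≡⟨ cong (λ m → π i * step i - π i * (m - 1ℚ)) (proj₁ hM i) ⟩
        π i * step i - π i * (0ℚ - 1ℚ)      ≡⟨ ab-a[0-1]≡a[b+1] (π i) (step i) ⟩
        π i * (step i + 1ℚ)                 ≡⟨ stationary*returnTime≡1 i ⟩
        1ℚ                                  ∎
        where
        ab-a[0-1]≡a[b+1] : ∀ a b → a * b - a * (0ℚ - 1ℚ) ≡ a * (b + 1ℚ)
        ab-a[0-1]≡a[b+1] a b = solve (a ∷ b ∷ []) ℚ-ring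
      p-1+1≡p : ∀ a → (a - 1ℚ) + 1ℚ ≡ a
      p-1+1≡p a = solve (a ∷ []) ℚ-ring

    kemenyFrom-constant : Connected → ∀ i i₀ → v i ≡ v i₀
    kemenyFrom-constant conn i i₀ =
      x∙y⁻¹≈ε⇒x≈y _ _ (harmonic-vanishes conn (ℚ.+-inverseʳ (v i₀)) (λ k _ → shifted-harmonic k) i)
      where
      shifted-harmonic : ∀ k → Harmonic (λ l → v l - v i₀) k
      shifted-harmonic k = begin
        v k - v i₀                                                  ≡⟨ cong (_- v i₀) (kemenyFrom-harmonic k) ⟩
        ∑[ l < N ] (p k l * v l) - v i₀                             ≡⟨ cong (λ x → ∑[ l < N ] (p k l * v l) - x) ∑p*vᵢ₀≡vᵢ₀ ⟨
        ∑[ l < N ] (p k l * v l) - ∑[ l < N ] (p k l * v i₀)        ≡⟨ ∑-distrib-- (λ l → p k l * v l) (λ l → p k l * v i₀) ⟨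
        ∑[ l < N ] (p k l * v l - p k l * v i₀)                     ≡⟨ sum-cong-≗ (λ l → *-distribˡ-- (p k l) (v l) (v i₀)) ⟨
        ∑[ l < N ] (p k l * (v l - v i₀))                           ∎
        where
        open ≡-Reasoning
        ∑p*vᵢ₀≡vᵢ₀ : ∑[ l < N ] (p k l * v i₀) ≡ v i₀
        ∑p*vᵢ₀≡vᵢ₀ = trans (sym (*-distribʳ-sum (v i₀) (p k)))
                     (trans (cong (_* v i₀) (transition-rowSum k (deg≢0 k))) (ℚ.*-identityˡ (v i₀)))

  isHittingTimes-intro : ∀ {M} → (∀ i → degree A i ≢ 0ℚ) → (∀ j → M j j ≡ 0ℚ) →
    (∀ i j → i ≢ j → degree A i * M i j ≡ degree A i + neighbourSum i (λ k → M k j)) → IsHittingTimes A M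
  isHittingTimes-intro {M} deg≢0 diagonal mean = diagonal , λ i j i≢j →
    trans (p*q≡p+r⇒q≡1+r÷₀p (deg≢0 i) (mean i j i≢j))
          (cong (1ℚ +_) (sym (trans (sumFin≡∑ N _) (transition-average i (λ k → M k j)))))

  kemenyFrom≡ : ∀ M i → kemenyFrom A M i ≡ (∑[ j < N ] (degree A j * M i j)) ÷₀ twiceEdges A
  kemenyFrom≡ M i = trans (sumFin≡∑ N _)
    (trans (sum-cong-≗ {N} (λ j → ÷₀-*ʳ (degree A j) (twiceEdges A) (M i j)))
           (∑-÷₀ (λ j → degree A j * M i j) (twiceEdges A)))

  twiceEdges≢0 : ∀ {i} → degree A i ≢ 0ℚ → twiceEdges A ≢ 0ℚ
  twiceEdges≢0 {i} dᵢ≢0 2m≡0 = dᵢ≢0 (nonneg-∑≡0 (degree A) degree-nonneg (trans (sym (sumFin≡∑ N _)) 2m≡0) i)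
    where
    degree-nonneg : ∀ k → 0ℚ ≤ degree A k
    degree-nonneg k = subst (0ℚ ≤_) (sym (degree≡∑ k)) (∑-nonneg (b2q ∘ A k) (b2q-nonneg ∘ A k))

  kemenyConstantIs-intro : Connected → (∀ i → degree A i ≢ 0ℚ) → twiceEdges A ≢ 0ℚ →
                           ∀ {M κ} → IsHittingTimes A M → ReturnTimes M →
                           ∀ i₀ → kemenyFrom A M i₀ ≡ κ → KemenyConstantIs A κ
  kemenyConstantIs-intro conn deg≢0 2m≢0 {M} {κ} hM return i₀ value = (M , hM) , λ M′ hM′ i → begin
    kemenyFrom A M′ i   ≡⟨ trans (sumFin≡∑ N _) (trans (sum-cong-≗ (λ j → cong (stationary A j *_) (hittingTimes-unique conn hM′ hM i j)))
                                                        (sym (sumFin≡∑ N _))) ⟩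
    kemenyFrom A M i    ≡⟨ kemenyFrom-constant deg≢0 2m≢0 hM return conn i i₀ ⟩
    kemenyFrom A M i₀   ≡⟨ value ⟩
    κ                   ∎
    where
    open ≡-Reasoning

ℕ→ℚ≡mkℚ : ∀ k → ℕ→ℚ k ≡ ℚ.mkℚ (ℤ.+ k) 0 (Coprime.sym (Coprime.1-coprimeTo k))
ℕ→ℚ≡mkℚ k = ℚ.normalize-coprime (Coprime.sym (Coprime.1-coprimeTo k))

ℕ→ℚ-suc : ∀ k → ℕ→ℚ (suc k) ≡ 1ℚ + ℕ→ℚ k
ℕ→ℚ-suc k = ℚ.toℚᵘ-injective (ℚᵘ.≃-trans unnormalised (ℚᵘ.≃-sym (ℚ.toℚᵘ-homo-+ 1ℚ (ℕ→ℚ k))))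
  where
  unnormalised : ℚ.toℚᵘ (ℕ→ℚ (suc k)) ℚᵘ.≃ ℚ.toℚᵘ 1ℚ ℚᵘ.+ ℚ.toℚᵘ (ℕ→ℚ k)
  unnormalised rewrite ℕ→ℚ≡mkℚ k | ℕ→ℚ≡mkℚ (suc k) | ℕ.*-identityʳ k | +◃n≡+n k = ℚᵘ.*≡* refl

ℕ→ℚ-2+ : ∀ x → ℕ→ℚ (suc (suc x)) ≡ 1ℚ + (1ℚ + ℕ→ℚ x)
ℕ→ℚ-2+ x = trans (ℕ→ℚ-suc (suc x)) (cong (1ℚ +_) (ℕ→ℚ-suc x))

ℕ→ℚ-suc≢0 : ∀ k → ℕ→ℚ (suc k) ≢ 0ℚ
ℕ→ℚ-suc≢0 k eq with trans (sym (ℕ→ℚ≡mkℚ (suc k))) eq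
... | ()

1+r+1≢0 : ∀ r → (1ℚ + ℕ→ℚ r) + 1ℚ ≢ 0ℚ
1+r+1≢0 r eq = ℕ→ℚ-suc≢0 (suc r) (trans (trans (ℕ→ℚ-2+ r) (ℚ.+-comm 1ℚ (1ℚ + ℕ→ℚ r))) eq)

ℕ→ℚ-+ : ∀ m n → ℕ→ℚ (m ℕ.+ n) ≡ ℕ→ℚ m + ℕ→ℚ n
ℕ→ℚ-+ zero    n = sym (ℚ.+-identityˡ (ℕ→ℚ n))
ℕ→ℚ-+ (suc m) n = begin
  ℕ→ℚ (suc (m ℕ.+ n))          ≡⟨ ℕ→ℚ-suc (m ℕ.+ n) ⟩
  1ℚ + ℕ→ℚ (m ℕ.+ n)           ≡⟨ cong (1ℚ +_) (ℕ→ℚ-+ m n) ⟩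
  1ℚ + (ℕ→ℚ m + ℕ→ℚ n)         ≡⟨ ℚ.+-assoc 1ℚ (ℕ→ℚ m) (ℕ→ℚ n) ⟨
  (1ℚ + ℕ→ℚ m) + ℕ→ℚ n         ≡⟨ cong (_+ ℕ→ℚ n) (ℕ→ℚ-suc m) ⟨
  ℕ→ℚ (suc m) + ℕ→ℚ n          ∎
  where open ≡-Reasoning

ℕ→ℚ-* : ∀ m n → ℕ→ℚ (m ℕ.* n) ≡ ℕ→ℚ m * ℕ→ℚ n
ℕ→ℚ-* zero    n = sym (ℚ.*-zeroˡ (ℕ→ℚ n))
ℕ→ℚ-* (suc m) n = begin
  ℕ→ℚ (n ℕ.+ m ℕ.* n)          ≡⟨ ℕ→ℚ-+ n (m ℕ.* n) ⟩
  ℕ→ℚ n + ℕ→ℚ (m ℕ.* n)        ≡⟨ cong (ℕ→ℚ n +_) (ℕ→ℚ-* m n) ⟩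
  ℕ→ℚ n + ℕ→ℚ m * ℕ→ℚ n        ≡⟨ cong (_+ ℕ→ℚ m * ℕ→ℚ n) (ℚ.*-identityˡ (ℕ→ℚ n)) ⟨
  1ℚ * ℕ→ℚ n + ℕ→ℚ m * ℕ→ℚ n   ≡⟨ ℚ.*-distribʳ-+ (ℕ→ℚ n) 1ℚ (ℕ→ℚ m) ⟨
  (1ℚ + ℕ→ℚ m) * ℕ→ℚ n         ≡⟨ cong (_* ℕ→ℚ n) (ℕ→ℚ-suc m) ⟨
  ℕ→ℚ (suc m) * ℕ→ℚ n          ∎
  where open ≡-Reasoning

≡ᵇ-refl : ∀ m → (m ≡ᵇ m) ≡ true
≡ᵇ-refl m = dec-true (m ℕ.≟ m) refl

≡ᵇ-false : ∀ {m n} → m ≢ n → (m ≡ᵇ n) ≡ false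
≡ᵇ-false {m} {n} = dec-false (m ℕ.≟ n)

≡ᵇ-sym : ∀ m n → (m ≡ᵇ n) ≡ (n ≡ᵇ m)
≡ᵇ-sym m n with m ℕ.≟ n
... | yes refl = refl
... | no m≢n   = trans (≡ᵇ-false m≢n) (sym (≡ᵇ-false (m≢n ∘ sym)))

≡ᵇ-+ˡ : ∀ a m n → (a ℕ.+ m ≡ᵇ a ℕ.+ n) ≡ (m ≡ᵇ n)
≡ᵇ-+ˡ zero    m n = refl
≡ᵇ-+ˡ (suc a) m n = ≡ᵇ-+ˡ a m n

<ᵇ-true : ∀ {m n} → m ℕ.< n → (m <ᵇ n) ≡ true
<ᵇ-true {m} {n} = dec-true (m ℕ.<? n)

<ᵇ-false : ∀ {m n} → n ℕ.≤ m → (m <ᵇ n) ≡ false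
<ᵇ-false {m} {n} n≤m = dec-false (m ℕ.<? n) (ℕ.≤⇒≯ n≤m)

≤ᵇ-true : ∀ {m n} → m ℕ.≤ n → (m ≤ᵇ n) ≡ true
≤ᵇ-true {m} {n} = dec-true (m ℕ.≤? n)

≤ᵇ-false : ∀ {m n} → n ℕ.< m → (m ≤ᵇ n) ≡ false
≤ᵇ-false {m} {n} n<m = dec-false (m ℕ.≤? n) (ℕ.<⇒≱ n<m)

sumℕ : ℕ → (ℕ → ℚ) → ℚ
sumℕ n f = ∑[ k < n ] f (Fin.toℕ k)

sumℕ-cong : ∀ n {f g : ℕ → ℚ} → (∀ {k} → k ℕ.< n → f k ≡ g k) → sumℕ n f ≡ sumℕ n g
sumℕ-cong n f≗g = sum-cong-≗ (λ k → f≗g (Fin.toℕ<n k))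

sumℕ-split : ∀ m n f → sumℕ (m ℕ.+ n) f ≡ sumℕ m f + sumℕ n (λ k → f (m ℕ.+ k))
sumℕ-split zero    n f = sym (ℚ.+-identityˡ _)
sumℕ-split (suc m) n f =
  trans (cong (f 0 +_) (sumℕ-split m n (f ∘ suc))) (sym (ℚ.+-assoc (f 0) _ _))

sumℕ-last : ∀ n f → sumℕ (suc n) f ≡ sumℕ n f + f n
sumℕ-last n f = trans (sum-init-last {n} (f ∘ Fin.toℕ)) (cong₂ _+_ init≡ (cong f (Fin.toℕ-fromℕ n)))
  where
  init≡ : ∑[ k < n ] f (Fin.toℕ (Fin.inject₁ k)) ≡ sumℕ n f
  init≡ = sum-cong-≗ {n} (λ k → cong f (Fin.toℕ-inject₁ k))

sumℕ-const : ∀ n c → sumℕ n (λ _ → c) ≡ ℕ→ℚ n * c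
sumℕ-const zero    c = sym (ℚ.*-zeroˡ c)
sumℕ-const (suc n) c = begin
  c + sumℕ n (λ _ → c)    ≡⟨ cong (c +_) (sumℕ-const n c) ⟩
  c + ℕ→ℚ n * c           ≡⟨ cong (_+ ℕ→ℚ n * c) (ℚ.*-identityˡ c) ⟨
  1ℚ * c + ℕ→ℚ n * c      ≡⟨ ℚ.*-distribʳ-+ c 1ℚ (ℕ→ℚ n) ⟨
  (1ℚ + ℕ→ℚ n) * c        ≡⟨ cong (_* c) (ℕ→ℚ-suc n) ⟨
  ℕ→ℚ (suc n) * c         ∎
  where open ≡-Reasoning

sumℕ-delta : ∀ {n t} (g : ℕ → ℚ) → t ℕ.< n → sumℕ n (λ k → b2q (k ≡ᵇ t) * g k) ≡ g t
sumℕ-delta {n} {t} g t<n = begin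
  sumℕ n (λ k → b2q (k ≡ᵇ t) * g k)              ≡⟨ ∑-delta _ (Fin.fromℕ< t<n) off-t ⟩
  b2q (Fin.toℕ (Fin.fromℕ< t<n) ≡ᵇ t) * g (Fin.toℕ (Fin.fromℕ< t<n))
                                                  ≡⟨ cong (λ k → b2q (k ≡ᵇ t) * g k) (Fin.toℕ-fromℕ< t<n) ⟩
  b2q (t ≡ᵇ t) * g t                              ≡⟨ cong (λ b → b2q b * g t) (≡ᵇ-refl t) ⟩
  1ℚ * g t                                        ≡⟨ ℚ.*-identityˡ (g t) ⟩
  g t                                             ∎
  where
  open ≡-Reasoning
  off-t : ∀ k → k ≢ Fin.fromℕ< t<n → b2q (Fin.toℕ k ≡ᵇ t) * g (Fin.toℕ k) ≡ 0ℚ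
  off-t k k≢t = trans (cong (λ b → b2q b * g (Fin.toℕ k)) (≡ᵇ-false (λ eq → k≢t (Fin.toℕ-injective
                  (trans eq (sym (Fin.toℕ-fromℕ< t<n)))))))
                  (ℚ.*-zeroˡ (g (Fin.toℕ k)))

sumℕ-id : ∀ n → ℕ→ℚ 2 * sumℕ n ℕ→ℚ ≡ ℕ→ℚ n * (ℕ→ℚ n - 1ℚ)
sumℕ-id zero    = refl
sumℕ-id (suc n) = begin
  ℕ→ℚ 2 * sumℕ (suc n) ℕ→ℚ                ≡⟨ cong (ℕ→ℚ 2 *_) (sumℕ-last n ℕ→ℚ) ⟩
  ℕ→ℚ 2 * (sumℕ n ℕ→ℚ + ℕ→ℚ n)            ≡⟨ step (sumℕ n ℕ→ℚ) (ℕ→ℚ n) (sumℕ-id n) ⟩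
  (1ℚ + ℕ→ℚ n) * ((1ℚ + ℕ→ℚ n) - 1ℚ)      ≡⟨ cong (λ x → x * (x - 1ℚ)) (ℕ→ℚ-suc n) ⟨
  ℕ→ℚ (suc n) * (ℕ→ℚ (suc n) - 1ℚ)        ∎
  where
  open ≡-Reasoning
  step : ∀ Σ x → ℕ→ℚ 2 * Σ ≡ x * (x - 1ℚ) → ℕ→ℚ 2 * (Σ + x) ≡ (1ℚ + x) * ((1ℚ + x) - 1ℚ)
  step Σ x ih = linear-combination ih 1ℚ (solve (Σ ∷ x ∷ []) ℚ-ring)

sumℕ-square : ∀ n → ℕ→ℚ 6 * sumℕ n (λ y → ℕ→ℚ y * ℕ→ℚ y) ≡ (ℕ→ℚ n - 1ℚ) * ℕ→ℚ n * (ℕ→ℚ 2 * ℕ→ℚ n - 1ℚ)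
sumℕ-square zero    = refl
sumℕ-square (suc n) = begin
  ℕ→ℚ 6 * sumℕ (suc n) sq                 ≡⟨ cong (ℕ→ℚ 6 *_) (sumℕ-last n sq) ⟩
  ℕ→ℚ 6 * (sumℕ n sq + sq n)              ≡⟨ step (sumℕ n sq) (ℕ→ℚ n) (sumℕ-square n) ⟩
  ((1ℚ + ℕ→ℚ n) - 1ℚ) * (1ℚ + ℕ→ℚ n) * (ℕ→ℚ 2 * (1ℚ + ℕ→ℚ n) - 1ℚ)
                                          ≡⟨ cong (λ x → (x - 1ℚ) * x * (ℕ→ℚ 2 * x - 1ℚ)) (ℕ→ℚ-suc n) ⟨
  (ℕ→ℚ (suc n) - 1ℚ) * ℕ→ℚ (suc n) * (ℕ→ℚ 2 * ℕ→ℚ (suc n) - 1ℚ)  ∎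
  where
  open ≡-Reasoning
  sq : ℕ → ℚ
  sq y = ℕ→ℚ y * ℕ→ℚ y
  step : ∀ Σ x → ℕ→ℚ 6 * Σ ≡ (x - 1ℚ) * x * (ℕ→ℚ 2 * x - 1ℚ) →
         ℕ→ℚ 6 * (Σ + x * x) ≡ ((1ℚ + x) - 1ℚ) * (1ℚ + x) * (ℕ→ℚ 2 * (1ℚ + x) - 1ℚ)
  step Σ x ih = linear-combination ih 1ℚ (solve (Σ ∷ x ∷ []) ℚ-ring)

sumℕ-delta-out : ∀ {n t} (g : ℕ → ℚ) → n ℕ.≤ t → sumℕ n (λ k → b2q (k ≡ᵇ t) * g k) ≡ 0ℚ
sumℕ-delta-out {n} {t} g n≤t = trans (sum-cong-≗ {n} vanish) (sum-replicate-zero n)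
  where
  vanish : ∀ k → b2q (Fin.toℕ k ≡ᵇ t) * g (Fin.toℕ k) ≡ 0ℚ
  vanish k = trans (cong (λ b → b2q b * g (Fin.toℕ k)) (≡ᵇ-false (ℕ.<⇒≢ (ℕ.<-≤-trans (Fin.toℕ<n k) n≤t))))
                   (ℚ.*-zeroˡ (g (Fin.toℕ k)))

sumℕ-all-but : ∀ {n x} (g : ℕ → ℚ) → x ℕ.< n → sumℕ n (λ k → b2q (not (x ≡ᵇ k)) * g k) ≡ sumℕ n g - g x
sumℕ-all-but {n} {x} g x<n = begin
  sumℕ n (λ k → b2q (not (x ≡ᵇ k)) * g k)          ≡⟨ sumℕ-cong n (λ {k} _ → b2q-not (x ≡ᵇ k) (g k)) ⟩
  sumℕ n (λ k → g k - b2q (x ≡ᵇ k) * g k)          ≡⟨ ∑-distrib-- {n} (g ∘ Fin.toℕ) (λ k → b2q (x ≡ᵇ Fin.toℕ k) * g (Fin.toℕ k)) ⟩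
  sumℕ n g - sumℕ n (λ k → b2q (x ≡ᵇ k) * g k)     ≡⟨ cong (λ y → sumℕ n g - y) (sumℕ-cong n (λ {k} _ → cong (λ b → b2q b * g k) (≡ᵇ-sym x k))) ⟩
  sumℕ n g - sumℕ n (λ k → b2q (k ≡ᵇ x) * g k)     ≡⟨ cong (λ y → sumℕ n g - y) (sumℕ-delta g x<n) ⟩
  sumℕ n g - g x                                   ∎
  where
  open ≡-Reasoning
  b2q-not : ∀ b y → b2q (not b) * y ≡ y - b2q b * y
  b2q-not true  y = solve (y ∷ []) ℚ-ring
  b2q-not false y = solve (y ∷ []) ℚ-ring

sumℕ-false : ∀ n (g : ℕ → ℚ) → sumℕ n (λ k → b2q false * g k) ≡ 0ℚ
sumℕ-false n g = trans (sum-cong-≗ {n} (λ k → ℚ.*-zeroˡ (g (Fin.toℕ k)))) (sum-replicate-zero n)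

-- The barbell graph B(1, s, s, s)

module Barbell (r : ℕ) where

  s : ℕ
  s = suc r

  N : ℕ
  N = s ℕ.+ s ℕ.+ s

  A : Adj N
  A = barbell s s s

  -- barbell s s s x y unfolds to adj (toℕ x) (toℕ y).
  adj : ℕ → ℕ → Bool
  adj u v = not (u ≡ᵇ v) ∧ link s (region s s u) (region s s v) u v

  adjSum : ℕ → (ℕ → ℚ) → ℚ
  adjSum u g = sumℕ N (λ k → b2q (adj u k) * g k)

  deg : ℕ → ℚ
  deg u = adjSum u (λ _ → 1ℚ)

  ∑Kb : (ℕ → ℚ) → ℚ
  ∑Kb g = sumℕ s (λ k → g (s ℕ.+ k))

  ∑Kc : (ℕ → ℚ) → ℚ
  ∑Kc g = sumℕ s (λ k → g (s ℕ.+ s ℕ.+ k))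

  sumℕ-N : ∀ g → sumℕ N g ≡ (sumℕ s g + ∑Kb g) + ∑Kc g
  sumℕ-N g = trans (sumℕ-split (s ℕ.+ s) s g) (cong (_+ ∑Kc g) (sumℕ-split s s g))

  data Vertex : ℕ → Set where
    path : ∀ {x} → x ℕ.< s → Vertex x
    inKb : ∀ {x} → x ℕ.< s → Vertex (s ℕ.+ x)
    inKc : ∀ {x} → x ℕ.< s → Vertex (s ℕ.+ s ℕ.+ x)

  vertex : ∀ {u} → u ℕ.< N → Vertex u
  vertex {u} u<N with u ℕ.<? s | u ℕ.<? s ℕ.+ s
  ... | yes u<s | _        = path u<s
  ... | no u≮s  | yes u<2s = subst Vertex (ℕ.m+[n∸m]≡n (ℕ.≮⇒≥ u≮s)) (inKb (ℕ.m<n+o⇒m∸n<o u s u<2s))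
  ... | no _    | no u≮2s  = subst Vertex (ℕ.m+[n∸m]≡n (ℕ.≮⇒≥ u≮2s)) (inKc (ℕ.m<n+o⇒m∸n<o u (s ℕ.+ s) u<N))

  s≤2s+ : ∀ x → s ℕ.≤ s ℕ.+ s ℕ.+ x
  s≤2s+ x = ℕ.≤-trans (ℕ.m≤m+n s s) (ℕ.m≤m+n (s ℕ.+ s) x)

  path<N : ∀ {x} → x ℕ.< s → x ℕ.< N
  path<N x<s = ℕ.<-≤-trans x<s (s≤2s+ s)

  Kb<N : ∀ {x} → x ℕ.< s → s ℕ.+ x ℕ.< N
  Kb<N x<s = ℕ.<-≤-trans (ℕ.+-monoʳ-< s x<s) (ℕ.m≤m+n (s ℕ.+ s) s)

  Kc<N : ∀ {x} → x ℕ.< s → s ℕ.+ s ℕ.+ x ℕ.< N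
  Kc<N x<s = ℕ.+-monoʳ-< (s ℕ.+ s) x<s

  0<s : 0 ℕ.< s
  0<s = s≤s z≤n

  r<s : r ℕ.< s
  r<s = ℕ.≤-refl

  region-path : ∀ {x} → x ℕ.< s → region s s x ≡ P
  region-path x<s rewrite <ᵇ-true x<s = refl

  region-Kb : ∀ {x} → x ℕ.< s → region s s (s ℕ.+ x) ≡ Kb
  region-Kb {x} x<s rewrite <ᵇ-false (ℕ.m≤m+n s x) | <ᵇ-true (ℕ.+-monoʳ-< s x<s) = refl

  region-Kc : ∀ {x} → x ℕ.< s → region s s (s ℕ.+ s ℕ.+ x) ≡ Kc
  region-Kc {x} x<s rewrite <ᵇ-false (s≤2s+ x) | <ᵇ-false (ℕ.m≤m+n (s ℕ.+ s) x) = refl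

  module _ {x k : ℕ} (x<s : x ℕ.< s) (k<s : k ℕ.< s) where

    adj-Kb-path : adj (s ℕ.+ x) k ≡ (k ≡ᵇ 0)
    adj-Kb-path rewrite region-Kb x<s | region-path k<s
                      | ≡ᵇ-false (ℕ.<⇒≢ (ℕ.<-≤-trans k<s (ℕ.m≤m+n s x)) ∘ sym) = refl

    adj-Kb-Kb : adj (s ℕ.+ x) (s ℕ.+ k) ≡ not (x ≡ᵇ k)
    adj-Kb-Kb rewrite region-Kb x<s | region-Kb k<s | ≡ᵇ-+ˡ s x k = Bool.∧-identityʳ _

    adj-Kb-Kc : adj (s ℕ.+ x) (s ℕ.+ s ℕ.+ k) ≡ false
    adj-Kb-Kc rewrite region-Kb x<s | region-Kc k<s = Bool.∧-zeroʳ _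

    adj-Kc-path : adj (s ℕ.+ s ℕ.+ x) k ≡ (k ≡ᵇ r)
    adj-Kc-path rewrite region-Kc x<s | region-path k<s
                      | ≡ᵇ-false (ℕ.<⇒≢ (ℕ.<-≤-trans k<s (s≤2s+ x)) ∘ sym) = refl

    adj-Kc-Kb : adj (s ℕ.+ s ℕ.+ x) (s ℕ.+ k) ≡ false
    adj-Kc-Kb rewrite region-Kc x<s | region-Kb k<s = Bool.∧-zeroʳ _

    adj-Kc-Kc : adj (s ℕ.+ s ℕ.+ x) (s ℕ.+ s ℕ.+ k) ≡ not (x ≡ᵇ k)
    adj-Kc-Kc rewrite region-Kc x<s | region-Kc k<s | ≡ᵇ-+ˡ (s ℕ.+ s) x k = Bool.∧-identityʳ _

    adj-path-path : adj x k ≡ not (x ≡ᵇ k) ∧ ((suc x ≡ᵇ k) ∨ (suc k ≡ᵇ x))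
    adj-path-path rewrite region-path x<s | region-path k<s = refl

    adj-path-Kb : adj x (s ℕ.+ k) ≡ (x ≡ᵇ 0)
    adj-path-Kb rewrite region-path x<s | region-Kb k<s
                      | ≡ᵇ-false (ℕ.<⇒≢ (ℕ.<-≤-trans x<s (ℕ.m≤m+n s k))) = refl

    adj-path-Kc : adj x (s ℕ.+ s ℕ.+ k) ≡ (x ≡ᵇ r)
    adj-path-Kc rewrite region-path x<s | region-Kc k<s
                      | ≡ᵇ-false (ℕ.<⇒≢ (ℕ.<-≤-trans x<s (s≤2s+ k))) = refl

  path-weight : ∀ x k → b2q (not (x ≡ᵇ k) ∧ ((suc x ≡ᵇ k) ∨ (suc k ≡ᵇ x))) ≡ b2q (k ≡ᵇ suc x) + b2q (suc k ≡ᵇ x)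
  path-weight zero          zero          = refl
  path-weight zero          (suc zero)    = refl
  path-weight zero          (suc (suc k)) = refl
  path-weight (suc zero)    zero          = refl
  path-weight (suc (suc x)) zero          = refl
  path-weight (suc x)       (suc k)       = path-weight x k

  ∑Kb-const : ∀ {g} c → (∀ {k} → k ℕ.< s → g (s ℕ.+ k) ≡ c) → ∑Kb g ≡ ℕ→ℚ s * c
  ∑Kb-const c g≡c = trans (sumℕ-cong s g≡c) (sumℕ-const s c)

  ∑Kc-const : ∀ {g} c → (∀ {k} → k ℕ.< s → g (s ℕ.+ s ℕ.+ k) ≡ c) → ∑Kc g ≡ ℕ→ℚ s * c
  ∑Kc-const c g≡c = trans (sumℕ-cong s g≡c) (sumℕ-const s c)

  adjSum-Kb : ∀ {x} → x ℕ.< s → ∀ g → adjSum (s ℕ.+ x) g ≡ g 0 + ∑Kb g - g (s ℕ.+ x)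
  adjSum-Kb {x} x<s g = begin
    adjSum (s ℕ.+ x) g                                 ≡⟨ sumℕ-N (λ k → b2q (adj (s ℕ.+ x) k) * g k) ⟩
    (sumℕ s (λ k → b2q (adj (s ℕ.+ x) k) * g k)
      + ∑Kb (λ k → b2q (adj (s ℕ.+ x) k) * g k))
      + ∑Kc (λ k → b2q (adj (s ℕ.+ x) k) * g k)       ≡⟨ cong₂ _+_ (cong₂ _+_ path-part Kb-part) Kc-part ⟩
    (g 0 + (∑Kb g - g (s ℕ.+ x))) + 0ℚ                 ≡⟨ tidy (g 0) (∑Kb g) (g (s ℕ.+ x)) ⟩
    g 0 + ∑Kb g - g (s ℕ.+ x)                          ∎
    where
    open ≡-Reasoning
    path-part = trans (sumℕ-cong s (λ {k} k<s → cong (λ b → b2q b * g (k)) (adj-Kb-path x<s k<s))) (sumℕ-delta {s} {0} g 0<s)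
    Kb-part = trans (sumℕ-cong s (λ {k} k<s → cong (λ b → b2q b * g (s ℕ.+ k)) (adj-Kb-Kb x<s k<s)))
                    (sumℕ-all-but (λ k → g (s ℕ.+ k)) x<s)
    Kc-part = trans (sumℕ-cong s (λ {k} k<s → cong (λ b → b2q b * g (s ℕ.+ s ℕ.+ k)) (adj-Kb-Kc x<s k<s))) (sumℕ-false s (λ k → g (s ℕ.+ s ℕ.+ k)))
    tidy : ∀ a b c → (a + (b - c)) + 0ℚ ≡ a + b - c
    tidy a b c = solve (a ∷ b ∷ c ∷ []) ℚ-ring

  adjSum-Kc : ∀ {x} → x ℕ.< s → ∀ g → adjSum (s ℕ.+ s ℕ.+ x) g ≡ g r + ∑Kc g - g (s ℕ.+ s ℕ.+ x)
  adjSum-Kc {x} x<s g = begin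
    adjSum (s ℕ.+ s ℕ.+ x) g                           ≡⟨ sumℕ-N (λ k → b2q (adj (s ℕ.+ s ℕ.+ x) k) * g k) ⟩
    (sumℕ s (λ k → b2q (adj (s ℕ.+ s ℕ.+ x) k) * g k)
      + ∑Kb (λ k → b2q (adj (s ℕ.+ s ℕ.+ x) k) * g k))
      + ∑Kc (λ k → b2q (adj (s ℕ.+ s ℕ.+ x) k) * g k)  ≡⟨ cong₂ _+_ (cong₂ _+_ path-part Kb-part) Kc-part ⟩
    (g r + 0ℚ) + (∑Kc g - g (s ℕ.+ s ℕ.+ x))           ≡⟨ tidy (g r) (∑Kc g) (g (s ℕ.+ s ℕ.+ x)) ⟩
    g r + ∑Kc g - g (s ℕ.+ s ℕ.+ x)                    ∎
    where
    open ≡-Reasoning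
    path-part = trans (sumℕ-cong s (λ {k} k<s → cong (λ b → b2q b * g (k)) (adj-Kc-path x<s k<s))) (sumℕ-delta {s} {r} g r<s)
    Kb-part = trans (sumℕ-cong s (λ {k} k<s → cong (λ b → b2q b * g (s ℕ.+ k)) (adj-Kc-Kb x<s k<s))) (sumℕ-false s (λ k → g (s ℕ.+ k)))
    Kc-part = trans (sumℕ-cong s (λ {k} k<s → cong (λ b → b2q b * g (s ℕ.+ s ℕ.+ k)) (adj-Kc-Kc x<s k<s)))
                    (sumℕ-all-but (λ k → g (s ℕ.+ s ℕ.+ k)) x<s)
    tidy : ∀ a b c → (a + 0ℚ) + (b - c) ≡ a + b - c
    tidy a b c = solve (a ∷ b ∷ c ∷ []) ℚ-ring

  rightNeighbour leftNeighbour : ℕ → (ℕ → ℚ) → ℚ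
  rightNeighbour x g = sumℕ s (λ k → b2q (k ≡ᵇ suc x) * g k)
  leftNeighbour  x g = sumℕ s (λ k → b2q (suc k ≡ᵇ x) * g k)

  adjSum-path : ∀ {x} → x ℕ.< s → ∀ g {a b c d} →
    rightNeighbour x g ≡ a → leftNeighbour x g ≡ b → b2q (x ≡ᵇ 0) ≡ c → b2q (x ≡ᵇ r) ≡ d →
    adjSum x g ≡ ((a + b) + c * ∑Kb g) + d * ∑Kc g
  adjSum-path {x} x<s g refl refl refl refl =
    trans (sumℕ-N (λ k → b2q (adj x k) * g k)) (cong₂ _+_ (cong₂ _+_ path-part Kb-part) Kc-part)
    where
    path-part = trans (sumℕ-cong s (λ {k} k<s → trans (cong (λ b → b2q b * g k) (adj-path-path x<s k<s))
                                  (trans (cong (_* g k) (path-weight x k))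
                                         (ℚ.*-distribʳ-+ (g k) (b2q (k ≡ᵇ suc x)) (b2q (suc k ≡ᵇ x))))))
                      (∑-distrib-+ {s} (λ k → b2q (Fin.toℕ k ≡ᵇ suc x) * g (Fin.toℕ k))
                                       (λ k → b2q (suc (Fin.toℕ k) ≡ᵇ x) * g (Fin.toℕ k)))
    Kb-part = trans (sumℕ-cong s (λ {k} k<s → cong (λ b → b2q b * g (s ℕ.+ k)) (adj-path-Kb x<s k<s)))
                    (sym (*-distribˡ-sum {s} (b2q (x ≡ᵇ 0)) (λ k → g (s ℕ.+ Fin.toℕ k))))
    Kc-part = trans (sumℕ-cong s (λ {k} k<s → cong (λ b → b2q b * g (s ℕ.+ s ℕ.+ k)) (adj-path-Kc x<s k<s)))
                    (sym (*-distribˡ-sum {s} (b2q (x ≡ᵇ r)) (λ k → g (s ℕ.+ s ℕ.+ Fin.toℕ k))))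

  -- lone: the path is a single vertex, joined to both cliques.
  data PathVertex : ℕ → Set where
    lone     : r ≡ 0 → PathVertex 0
    leftEnd  : 0 ℕ.< r → PathVertex 0
    interior : ∀ {x} → suc (suc x) ℕ.< s → PathVertex (suc x)
    rightEnd : ∀ {x} → r ≡ suc x → PathVertex r

  pathVertex : ∀ {x} → x ℕ.< s → PathVertex x
  pathVertex {zero} _ with r ℕ.≟ 0
  ... | yes r≡0 = lone r≡0
  ... | no r≢0  = leftEnd (ℕ.n≢0⇒n>0 r≢0)
  pathVertex {suc x} x<s with suc (suc x) ℕ.<? s
  ... | yes x+2<s = interior x+2<s
  ... | no x+2≮s  = subst PathVertex r≡x+1 (rightEnd r≡x+1)
    where
    r≡x+1 : r ≡ suc x
    r≡x+1 = ℕ.≤-antisym (ℕ.≤-pred (ℕ.≮⇒≥ x+2≮s)) (ℕ.≤-pred x<s)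

  interior<s : ∀ {x} → suc (suc x) ℕ.< s → x ℕ.< s × suc x ℕ.< s
  interior<s {x} x+2<s = ℕ.<-trans (ℕ.n<1+n x) x+1<s , x+1<s
    where x+1<s = ℕ.<-trans (ℕ.n<1+n (suc x)) x+2<s

  rightEnd<s : ∀ {x} → r ≡ suc x → x ℕ.< s
  rightEnd<s {x} r≡x+1 = ℕ.<-trans (ℕ.n<1+n x) (subst (ℕ._< s) r≡x+1 r<s)

  adjSum-lone : r ≡ 0 → ∀ g → adjSum 0 g ≡ ∑Kb g + ∑Kc g
  adjSum-lone r≡0 g = trans
    (adjSum-path 0<s g (sumℕ-delta-out {s} {1} g (ℕ.≤-reflexive (cong suc r≡0))) (sumℕ-false s g) refl
                     (cong (λ t → b2q (0 ≡ᵇ t)) r≡0))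
    (tidy (∑Kb g) (∑Kc g))
    where
    tidy : ∀ b c → ((0ℚ + 0ℚ) + 1ℚ * b) + 1ℚ * c ≡ b + c
    tidy b c = solve (b ∷ c ∷ []) ℚ-ring

  adjSum-leftEnd : 0 ℕ.< r → ∀ g → adjSum 0 g ≡ g 1 + ∑Kb g
  adjSum-leftEnd 0<r g = trans
    (adjSum-path 0<s g (sumℕ-delta {s} {1} g (s≤s 0<r)) (sumℕ-false s g) refl (cong b2q (≡ᵇ-false (ℕ.<⇒≢ 0<r))))
    (tidy (g 1) (∑Kb g) (∑Kc g))
    where
    tidy : ∀ a b c → ((a + 0ℚ) + 1ℚ * b) + 0ℚ * c ≡ a + b
    tidy a b c = solve (a ∷ b ∷ c ∷ []) ℚ-ring

  adjSum-interior : ∀ {x} → suc (suc x) ℕ.< s → ∀ g → adjSum (suc x) g ≡ g x + g (suc (suc x))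
  adjSum-interior {x} x+2<s g = trans
    (adjSum-path (proj₂ (interior<s x+2<s)) g (sumℕ-delta {s} {suc (suc x)} g x+2<s)
                 (sumℕ-delta {s} {x} g (proj₁ (interior<s x+2<s))) refl
                 (cong b2q (≡ᵇ-false (ℕ.<⇒≢ (ℕ.≤-pred x+2<s)))))
    (tidy (g x) (g (suc (suc x))) (∑Kb g) (∑Kc g))
    where
    tidy : ∀ a b c d → ((b + a) + 0ℚ * c) + 0ℚ * d ≡ a + b
    tidy a b c d = solve (a ∷ b ∷ c ∷ d ∷ []) ℚ-ring

  adjSum-rightEnd : ∀ {x} → r ≡ suc x → ∀ g → adjSum r g ≡ g x + ∑Kc g
  adjSum-rightEnd {x} r≡x+1 g = trans
    (adjSum-path r<s g (sumℕ-delta-out {s} {suc r} g ℕ.≤-refl)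
                 (trans (cong (λ t → leftNeighbour t g) r≡x+1) (sumℕ-delta {s} {x} g (rightEnd<s r≡x+1)))
                 (cong (λ t → b2q (t ≡ᵇ 0)) r≡x+1) (cong b2q (≡ᵇ-refl r)))
    (tidy (g x) (∑Kb g) (∑Kc g))
    where
    tidy : ∀ a b c → ((0ℚ + a) + 0ℚ * b) + 1ℚ * c ≡ a + c
    tidy a b c = solve (a ∷ b ∷ c ∷ []) ℚ-ring

  degree≡deg : ∀ i → degree A i ≡ deg (Fin.toℕ i)
  degree≡deg i = trans (sumFin≡∑ N (b2q ∘ A i)) (sum-cong-≗ {N} (λ k → sym (ℚ.*-identityʳ (b2q (A i k)))))

  twiceEdges≡∑deg : twiceEdges A ≡ sumℕ N deg
  twiceEdges≡∑deg = trans (sumFin≡∑ N (degree A)) (sum-cong-≗ {N} degree≡deg)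

  open RandomWalk A using (Walk; []; _∷_; _++_; Connected)

  ⟨_⟩ : ∀ {u} → u ℕ.< N → Fin N
  ⟨ u<N ⟩ = Fin.fromℕ< u<N

  edge : ∀ {u v} (u<N : u ℕ.< N) (v<N : v ℕ.< N) → adj u v ≡ true → A ⟨ u<N ⟩ ⟨ v<N ⟩ ≡ true
  edge u<N v<N adj≡true =
    subst₂ (λ a b → adj a b ≡ true) (sym (Fin.toℕ-fromℕ< u<N)) (sym (Fin.toℕ-fromℕ< v<N)) adj≡true

  adj-path-down : ∀ {x} → suc x ℕ.< s → adj (suc x) x ≡ true
  adj-path-down {x} x+1<s = trans (adj-path-path x+1<s (ℕ.<-trans (ℕ.n<1+n x) x+1<s))
    (trans (cong₂ (λ a b → not a ∧ ((suc (suc x) ≡ᵇ x) ∨ b)) (≡ᵇ-false {suc x} {x} ℕ.1+n≢n) (≡ᵇ-refl x))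
           (Bool.∨-zeroʳ _))

  adj-path-up : ∀ {x} → suc x ℕ.< s → adj x (suc x) ≡ true
  adj-path-up {x} x+1<s = trans (adj-path-path (ℕ.<-trans (ℕ.n<1+n x) x+1<s) x+1<s)
    (cong₂ (λ a b → not a ∧ (b ∨ (suc (suc x) ≡ᵇ x))) (≡ᵇ-false {x} {suc x} (ℕ.1+n≢n ∘ sym)) (≡ᵇ-refl x))

  walk-down : ∀ {x} (x<s : x ℕ.< s) → Walk ⟨ path<N x<s ⟩ ⟨ path<N 0<s ⟩
  walk-down {zero}  _     = []
  walk-down {suc x} x+1<s = edge (path<N x+1<s) (path<N x<s) (adj-path-down x+1<s) ∷ walk-down x<s
    where x<s = ℕ.<-trans (ℕ.n<1+n x) x+1<s

  walk-up : ∀ {x} (x<s : x ℕ.< s) → Walk ⟨ path<N 0<s ⟩ ⟨ path<N x<s ⟩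
  walk-up {zero}  _     = []
  walk-up {suc x} x+1<s = walk-up x<s ++ edge (path<N x<s) (path<N x+1<s) (adj-path-up x+1<s) ∷ []
    where x<s = ℕ.<-trans (ℕ.n<1+n x) x+1<s

  vertex<N : ∀ {u} → Vertex u → u ℕ.< N
  vertex<N (path x<s) = path<N x<s
  vertex<N (inKb x<s) = Kb<N x<s
  vertex<N (inKc x<s) = Kc<N x<s

  walk-to-0 : ∀ {u} (v : Vertex u) → Walk ⟨ vertex<N v ⟩ ⟨ path<N 0<s ⟩
  walk-to-0 (path x<s) = walk-down x<s
  walk-to-0 (inKb x<s) = edge (Kb<N x<s) (path<N 0<s) (adj-Kb-path x<s 0<s) ∷ []
  walk-to-0 (inKc x<s) =
    edge (Kc<N x<s) (path<N r<s) (trans (adj-Kc-path x<s r<s) (≡ᵇ-refl r)) ∷ walk-down r<s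

  walk-from-0 : ∀ {u} (v : Vertex u) → Walk ⟨ path<N 0<s ⟩ ⟨ vertex<N v ⟩
  walk-from-0 (path x<s) = walk-up x<s
  walk-from-0 (inKb x<s) = edge (path<N 0<s) (Kb<N x<s) (adj-path-Kb 0<s x<s) ∷ []
  walk-from-0 (inKc x<s) =
    walk-up r<s ++ edge (path<N r<s) (Kc<N x<s) (trans (adj-path-Kc r<s x<s) (≡ᵇ-refl r)) ∷ []

  connected : Connected
  connected i j = subst₂ Walk (Fin.fromℕ<-toℕ i _) (Fin.fromℕ<-toℕ j _)
    (walk-to-0 (vertex (Fin.toℕ<n i)) ++ walk-from-0 (vertex (Fin.toℕ<n j)))

-- Hitting times in B(1, s, s, s)

-- Binding the abbreviations by λ rather than by definitions makes a statement phrased with them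
-- unfold to a plain polynomial identity, which is what the ring solver needs.
with-polynomials : ∀ {a} {A : Set a} → ℚ → ℚ → (ℚ → ℚ → ℚ → ℚ → (ℚ → ℚ) → (ℚ → ℚ) → A) → A
with-polynomials R U k =
  let S = 1ℚ + R
      q = S * (S + 1ℚ)
  in k S q (ℕ→ℚ 2 * S * S + ℕ→ℚ 4 * S - ℕ→ℚ 2) (ℕ→ℚ 2 * U - S)
       (λ z → z * q + z * z) (λ z → (R - z) * (R - z) - z * q)

-- S = s, R = s - 1 and W = 2m.  Φ y - Φ x (x ≤ y) and Ψ y - Ψ x (y ≤ x) are the times to walk
-- along the path from x to y: crossing a path edge takes 2e + 1 steps on average, e the number of
-- edges behind it, which gives Φ (z + 1) - Φ z = q + 2z + 1.  U is the hitting time between two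
-- vertices of one clique, fixed by U (S + 1) = W, and T = 2U - S the time from an end of the path
-- into a vertex of its clique.  R and U are parameters rather than ℕ→ℚ r and W ÷₀ (S + 1) so
-- that the ring solver sees them as variables.
module BarbellHitting (r : ℕ) (R U : ℚ) (r≡R : ℕ→ℚ r ≡ R)
  (U[S+1]≡W : U * ((1ℚ + R) + 1ℚ) ≡ ℕ→ℚ 2 * (1ℚ + R) * (1ℚ + R) + ℕ→ℚ 4 * (1ℚ + R) - ℕ→ℚ 2) where

  S q W T : ℚ
  S = with-polynomials R U λ S _ _ _ _ _ → S
  q = with-polynomials R U λ _ q _ _ _ _ → q
  W = with-polynomials R U λ _ _ W _ _ _ → W
  T = with-polynomials R U λ _ _ _ T _ _ → T

  Φ Ψ : ℚ → ℚ
  Φ = with-polynomials R U λ _ _ _ _ Φ _ → Φ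
  Ψ = with-polynomials R U λ _ _ _ _ _ Ψ → Ψ

  Expanded : (ℚ → ℚ → ℚ → ℚ → (ℚ → ℚ) → (ℚ → ℚ) → Set) → Set
  Expanded = with-polynomials R U

  open Barbell r

  hitting : Region → Region → ℕ → ℕ → ℚ
  hitting Kb Kb u v = if u ≡ᵇ v then 0ℚ else U
  hitting Kc Kc u v = if u ≡ᵇ v then 0ℚ else U
  hitting P  P  u v = if u ≤ᵇ v then Φ (ℕ→ℚ v) - Φ (ℕ→ℚ u) else Ψ (ℕ→ℚ v) - Ψ (ℕ→ℚ u)
  hitting P  Kb u _ = (Ψ 0ℚ + T) - Ψ (ℕ→ℚ u)
  hitting Kc Kb _ _ = S + Ψ 0ℚ - Ψ R + T
  hitting Kb P  _ v = S + Φ (ℕ→ℚ v)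
  hitting Kc P  _ v = S + Ψ (ℕ→ℚ v) - Ψ R
  hitting P  Kc u _ = (Φ R + T) - Φ (ℕ→ℚ u)
  hitting Kb Kc _ _ = S + Φ R + T

  H : ℕ → ℕ → ℚ
  H u v = hitting (region s s u) (region s s v) u v

  s≡S : ℕ→ℚ s ≡ S
  s≡S = trans (ℕ→ℚ-suc r) (cong (1ℚ +_) r≡R)

  H-at : ∀ u v {a b} → region s s u ≡ a → region s s v ≡ b → H u v ≡ hitting a b u v
  H-at u v reg-u reg-v = cong₂ (λ a b → hitting a b u v) reg-u reg-v

  module _ {x y : ℕ} (x<s : x ℕ.< s) (y<s : y ℕ.< s) where

    H-Kb-Kb : H (s ℕ.+ x) (s ℕ.+ y) ≡ (if x ≡ᵇ y then 0ℚ else U)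
    H-Kb-Kb = trans (H-at (s ℕ.+ x) (s ℕ.+ y) (region-Kb x<s) (region-Kb y<s)) (cong (λ b → if b then 0ℚ else U) (≡ᵇ-+ˡ s x y))

    H-Kc-Kc : H (s ℕ.+ s ℕ.+ x) (s ℕ.+ s ℕ.+ y) ≡ (if x ≡ᵇ y then 0ℚ else U)
    H-Kc-Kc = trans (H-at (s ℕ.+ s ℕ.+ x) (s ℕ.+ s ℕ.+ y) (region-Kc x<s) (region-Kc y<s)) (cong (λ b → if b then 0ℚ else U) (≡ᵇ-+ˡ (s ℕ.+ s) x y))

    H-path-Kb : H x (s ℕ.+ y) ≡ (Ψ 0ℚ + T) - Ψ (ℕ→ℚ x)
    H-path-Kb = H-at x (s ℕ.+ y) (region-path x<s) (region-Kb y<s)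

    H-Kc-Kb : H (s ℕ.+ s ℕ.+ x) (s ℕ.+ y) ≡ S + Ψ 0ℚ - Ψ R + T
    H-Kc-Kb = H-at (s ℕ.+ s ℕ.+ x) (s ℕ.+ y) (region-Kc x<s) (region-Kb y<s)

    H-Kb-path : H (s ℕ.+ x) y ≡ S + Φ (ℕ→ℚ y)
    H-Kb-path = H-at (s ℕ.+ x) y (region-Kb x<s) (region-path y<s)

    H-Kc-path : H (s ℕ.+ s ℕ.+ x) y ≡ S + Ψ (ℕ→ℚ y) - Ψ R
    H-Kc-path = H-at (s ℕ.+ s ℕ.+ x) y (region-Kc x<s) (region-path y<s)

    H-path-Kc : H x (s ℕ.+ s ℕ.+ y) ≡ (Φ R + T) - Φ (ℕ→ℚ x)
    H-path-Kc = H-at x (s ℕ.+ s ℕ.+ y) (region-path x<s) (region-Kc y<s)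

    H-Kb-Kc : H (s ℕ.+ x) (s ℕ.+ s ℕ.+ y) ≡ S + Φ R + T
    H-Kb-Kc = H-at (s ℕ.+ x) (s ℕ.+ s ℕ.+ y) (region-Kb x<s) (region-Kc y<s)

    H-path-≤ : x ℕ.≤ y → H x y ≡ Φ (ℕ→ℚ y) - Φ (ℕ→ℚ x)
    H-path-≤ x≤y = trans (H-at x y (region-path x<s) (region-path y<s))
      (cong (λ b → if b then Φ (ℕ→ℚ y) - Φ (ℕ→ℚ x) else Ψ (ℕ→ℚ y) - Ψ (ℕ→ℚ x)) (≤ᵇ-true x≤y))

    H-path-≥ : y ℕ.≤ x → H x y ≡ Ψ (ℕ→ℚ y) - Ψ (ℕ→ℚ x)
    H-path-≥ y≤x with ℕ.m≤n⇒m<n∨m≡n y≤x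
    ... | inj₁ y<x = trans (H-at x y (region-path x<s) (region-path y<s))
      (cong (λ b → if b then Φ (ℕ→ℚ y) - Φ (ℕ→ℚ x) else Ψ (ℕ→ℚ y) - Ψ (ℕ→ℚ x)) (≤ᵇ-false y<x))
    ... | inj₂ refl = trans (H-path-≤ ℕ.≤-refl) (trans (ℚ.+-inverseʳ (Φ (ℕ→ℚ x))) (sym (ℚ.+-inverseʳ (Ψ (ℕ→ℚ x)))))

  H-Kb-diag : ∀ {x} → x ℕ.< s → H (s ℕ.+ x) (s ℕ.+ x) ≡ 0ℚ
  H-Kb-diag {x} x<s = trans (H-Kb-Kb x<s x<s) (cong (λ b → if b then 0ℚ else U) (≡ᵇ-refl x))

  H-Kc-diag : ∀ {x} → x ℕ.< s → H (s ℕ.+ s ℕ.+ x) (s ℕ.+ s ℕ.+ x) ≡ 0ℚ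
  H-Kc-diag {x} x<s = trans (H-Kc-Kc x<s x<s) (cong (λ b → if b then 0ℚ else U) (≡ᵇ-refl x))

  H-Kb-≢ : ∀ {x y} → x ℕ.< s → y ℕ.< s → x ≢ y → H (s ℕ.+ x) (s ℕ.+ y) ≡ U
  H-Kb-≢ x<s y<s x≢y = trans (H-Kb-Kb x<s y<s) (cong (λ b → if b then 0ℚ else U) (≡ᵇ-false x≢y))

  H-Kc-≢ : ∀ {x y} → x ℕ.< s → y ℕ.< s → x ≢ y → H (s ℕ.+ s ℕ.+ x) (s ℕ.+ s ℕ.+ y) ≡ U
  H-Kc-≢ x<s y<s x≢y = trans (H-Kc-Kc x<s y<s) (cong (λ b → if b then 0ℚ else U) (≡ᵇ-false x≢y))

  H-path-diag : ∀ {x} → x ℕ.< s → H x x ≡ 0ℚ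
  H-path-diag {x} x<s = trans (H-path-≤ x<s x<s ℕ.≤-refl) (ℚ.+-inverseʳ (Φ (ℕ→ℚ x)))

  clique-sum : ∀ {y} → y ℕ.< s → sumℕ s (λ k → if k ≡ᵇ y then 0ℚ else U) ≡ U * R
  clique-sum {y} y<s = begin
    sumℕ s (λ k → if k ≡ᵇ y then 0ℚ else U)          ≡⟨ sumℕ-cong s (λ {k} _ → trans (if-0-U (k ≡ᵇ y)) (cong (λ b → b2q (not b) * U) (≡ᵇ-sym k y))) ⟩
    sumℕ s (λ k → b2q (not (y ≡ᵇ k)) * U)            ≡⟨ sumℕ-all-but (λ _ → U) y<s ⟩
    sumℕ s (λ _ → U) - U                             ≡⟨ cong (_- U) (trans (sumℕ-const s U) (cong (_* U) s≡S)) ⟩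
    S * U - U                                        ≡⟨ S*U-U≡U*R ⟩
    U * R                                            ∎
    where
    open ≡-Reasoning
    S*U-U≡U*R : Expanded λ S _ _ _ _ _ → S * U - U ≡ U * R
    S*U-U≡U*R = solve (R ∷ U ∷ []) ℚ-ring
    if-0-U : ∀ b → (if b then 0ℚ else U) ≡ b2q (not b) * U
    if-0-U true  = sym (ℚ.*-zeroˡ U)
    if-0-U false = sym (ℚ.*-identityˡ U)

  ∑Kb-clique : ∀ {y} → y ℕ.< s → ∑Kb (λ k → H k (s ℕ.+ y)) ≡ U * R
  ∑Kb-clique y<s = trans (sumℕ-cong s (λ k<s → H-Kb-Kb k<s y<s)) (clique-sum y<s)

  ∑Kc-clique : ∀ {y} → y ℕ.< s → ∑Kc (λ k → H k (s ℕ.+ s ℕ.+ y)) ≡ U * R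
  ∑Kc-clique y<s = trans (sumℕ-cong s (λ k<s → H-Kc-Kc k<s y<s)) (clique-sum y<s)

  ∑Kb-uniform : ∀ {g} c → (∀ {k} → k ℕ.< s → g (s ℕ.+ k) ≡ c) → ∑Kb g ≡ S * c
  ∑Kb-uniform {g} c g≡c = trans (∑Kb-const {g} c g≡c) (cong (_* c) s≡S)

  ∑Kc-uniform : ∀ {g} c → (∀ {k} → k ℕ.< s → g (s ℕ.+ s ℕ.+ k) ≡ c) → ∑Kc g ≡ S * c
  ∑Kc-uniform {g} c g≡c = trans (∑Kc-const {g} c g≡c) (cong (_* c) s≡S)

  deg-Kb : ∀ {x} → x ℕ.< s → deg (s ℕ.+ x) ≡ S
  deg-Kb x<s = trans (adjSum-Kb x<s (λ _ → 1ℚ))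
    (trans (cong (λ c → 1ℚ + c - 1ℚ) (∑Kb-uniform {λ _ → 1ℚ} 1ℚ (λ _ → refl))) (1+p*1-1≡p S))

  deg-Kc : ∀ {x} → x ℕ.< s → deg (s ℕ.+ s ℕ.+ x) ≡ S
  deg-Kc x<s = trans (adjSum-Kc x<s (λ _ → 1ℚ))
    (trans (cong (λ c → 1ℚ + c - 1ℚ) (∑Kc-uniform {λ _ → 1ℚ} 1ℚ (λ _ → refl))) (1+p*1-1≡p S))

  deg-lone : r ≡ 0 → deg 0 ≡ S + S
  deg-lone r≡0 = trans (adjSum-lone r≡0 (λ _ → 1ℚ))
    (trans (cong₂ _+_ (∑Kb-uniform {λ _ → 1ℚ} 1ℚ (λ _ → refl)) (∑Kc-uniform {λ _ → 1ℚ} 1ℚ (λ _ → refl)))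
           (cong₂ _+_ (ℚ.*-identityʳ S) (ℚ.*-identityʳ S)))

  deg-leftEnd : 0 ℕ.< r → deg 0 ≡ 1ℚ + S
  deg-leftEnd 0<r = trans (adjSum-leftEnd 0<r (λ _ → 1ℚ))
    (cong (1ℚ +_) (trans (∑Kb-uniform {λ _ → 1ℚ} 1ℚ (λ _ → refl)) (ℚ.*-identityʳ S)))

  deg-interior : ∀ {x} → suc (suc x) ℕ.< s → deg (suc x) ≡ 1ℚ + 1ℚ
  deg-interior x+2<s = adjSum-interior x+2<s (λ _ → 1ℚ)

  deg-rightEnd : ∀ {x} → r ≡ suc x → deg r ≡ 1ℚ + S
  deg-rightEnd r≡x+1 = trans (adjSum-rightEnd r≡x+1 (λ _ → 1ℚ))
    (cong (1ℚ +_) (trans (∑Kc-uniform {λ _ → 1ℚ} 1ℚ (λ _ → refl)) (ℚ.*-identityʳ S)))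

  R≡0 : r ≡ 0 → R ≡ 0ℚ
  R≡0 r≡0 = trans (sym r≡R) (cong ℕ→ℚ r≡0)

  R≡1+x : ∀ {x} → r ≡ suc x → R ≡ 1ℚ + ℕ→ℚ x
  R≡1+x {x} r≡x+1 = trans (sym r≡R) (trans (cong ℕ→ℚ r≡x+1) (ℕ→ℚ-suc x))

  Φ-second-difference : ∀ a X → Expanded λ _ _ _ _ Φ _ →
    (1ℚ + 1ℚ) * (a - Φ (1ℚ + X)) ≡ (1ℚ + 1ℚ) + ((a - Φ X) + (a - Φ (1ℚ + (1ℚ + X))))
  Φ-second-difference a X = solve (R ∷ a ∷ X ∷ []) ℚ-ring

  Ψ-second-difference : ∀ a X → Expanded λ _ _ _ _ _ Ψ →
    (1ℚ + 1ℚ) * (a - Ψ (1ℚ + X)) ≡ (1ℚ + 1ℚ) + ((a - Ψ X) + (a - Ψ (1ℚ + (1ℚ + X))))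
  Ψ-second-difference a X = solve (R ∷ a ∷ X ∷ []) ℚ-ring

  HittingEquation : ℕ → ℕ → Set
  HittingEquation u v = deg u * H u v ≡ deg u + adjSum u (λ k → H k v)

  hitting-equation : ∀ u v {d h n} → deg u ≡ d → H u v ≡ h → adjSum u (λ k → H k v) ≡ n →
                     d * h ≡ d + n → HittingEquation u v
  hitting-equation _ _ refl refl refl d*h≡d+n = d*h≡d+n

  module ToKb {y : ℕ} (y<s : y ℕ.< s) where

    private
      g : ℕ → ℚ
      g k = H k (s ℕ.+ y)

      ∑Kc-g : ∑Kc g ≡ S * (S + Ψ 0ℚ - Ψ R + T)
      ∑Kc-g = ∑Kc-uniform {g} _ (λ k<s → H-Kc-Kb k<s y<s)

      g-r : g r ≡ (Ψ 0ℚ + T) - Ψ R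
      g-r = trans (H-path-Kb r<s y<s) (cong (λ z → (Ψ 0ℚ + T) - Ψ z) r≡R)

    from-Kb : ∀ {x} → x ℕ.< s → x ≢ y → HittingEquation (s ℕ.+ x) (s ℕ.+ y)
    from-Kb {x} x<s x≢y = hitting-equation (s ℕ.+ x) (s ℕ.+ y) (deg-Kb x<s) (H-Kb-≢ x<s y<s x≢y)
      (trans (adjSum-Kb x<s g) (cong₂ _-_ (cong₂ _+_ (H-path-Kb 0<s y<s) (∑Kb-clique y<s)) (H-Kb-≢ x<s y<s x≢y)))
      identity
      where
      identity : Expanded λ S q W T Φ Ψ → S * U ≡ S + (((Ψ 0ℚ + T) - Ψ (ℕ→ℚ 0)) + U * R - U)
      identity = solve (R ∷ U ∷ []) ℚ-ring

    from-Kc : ∀ {x} → x ℕ.< s → HittingEquation (s ℕ.+ s ℕ.+ x) (s ℕ.+ y)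
    from-Kc {x} x<s = hitting-equation (s ℕ.+ s ℕ.+ x) (s ℕ.+ y) (deg-Kc x<s) (H-Kc-Kb x<s y<s)
      (trans (adjSum-Kc x<s g) (cong₂ _-_ (cong₂ _+_ g-r ∑Kc-g) (H-Kc-Kb x<s y<s)))
      identity
      where
      identity : Expanded λ S q W T Φ Ψ →
        S * (S + Ψ 0ℚ - Ψ R + T) ≡ S + (((Ψ 0ℚ + T) - Ψ R) + S * (S + Ψ 0ℚ - Ψ R + T) - (S + Ψ 0ℚ - Ψ R + T))
      identity = solve (R ∷ U ∷ []) ℚ-ring

    from-path : ∀ {x} → x ℕ.< s → HittingEquation x (s ℕ.+ y)
    from-path u<s with pathVertex u<s
    ... | lone r≡0 = hitting-equation 0 (s ℕ.+ y) (deg-lone r≡0) (H-path-Kb 0<s y<s)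
      (trans (adjSum-lone r≡0 g) (cong₂ _+_ (∑Kb-clique y<s) ∑Kc-g))
      (identity (R≡0 r≡0))
      where
      identity : Expanded λ S q W T Φ Ψ → R ≡ 0ℚ →
        (S + S) * ((Ψ 0ℚ + T) - Ψ (ℕ→ℚ 0)) ≡ (S + S) + (U * R + S * (S + Ψ 0ℚ - Ψ R + T))
      identity R≡0 = linear-combination U[S+1]≡W 1ℚ
        (linear-combination R≡0 (- (R * R * R + ℕ→ℚ 5 * R * R + ℕ→ℚ 6 * R)) (solve (R ∷ U ∷ []) ℚ-ring))
    ... | leftEnd 0<r = hitting-equation 0 (s ℕ.+ y) (deg-leftEnd 0<r) (H-path-Kb 0<s y<s)
      (trans (adjSum-leftEnd 0<r g) (cong₂ _+_ (H-path-Kb (s≤s 0<r) y<s) (∑Kb-clique y<s)))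
      identity
      where
      identity : Expanded λ S q W T Φ Ψ →
        (1ℚ + S) * ((Ψ 0ℚ + T) - Ψ (ℕ→ℚ 0)) ≡ (1ℚ + S) + (((Ψ 0ℚ + T) - Ψ (ℕ→ℚ 1)) + U * R)
      identity = linear-combination U[S+1]≡W 1ℚ (solve (R ∷ U ∷ []) ℚ-ring)
    ... | interior {x} x+2<s = hitting-equation (suc x) (s ℕ.+ y) (deg-interior x+2<s)
      (trans (H-path-Kb x+1<s y<s) (cong (λ z → (Ψ 0ℚ + T) - Ψ z) (ℕ→ℚ-suc x)))
      (trans (adjSum-interior x+2<s g) (cong₂ _+_ (H-path-Kb x<s y<s)
        (trans (H-path-Kb x+2<s y<s) (cong (λ z → (Ψ 0ℚ + T) - Ψ z) (ℕ→ℚ-2+ x)))))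
      (Ψ-second-difference (Ψ 0ℚ + T) (ℕ→ℚ x))
      where
      x<s = proj₁ (interior<s x+2<s)
      x+1<s = proj₂ (interior<s x+2<s)
    ... | rightEnd {x} r≡x+1 = hitting-equation r (s ℕ.+ y) (deg-rightEnd r≡x+1) g-r
      (trans (adjSum-rightEnd r≡x+1 g) (cong₂ _+_ (H-path-Kb (rightEnd<s r≡x+1) y<s) ∑Kc-g))
      (identity (ℕ→ℚ x) (R≡1+x r≡x+1))
      where
      identity : ∀ X → Expanded λ S q W T Φ Ψ → R ≡ 1ℚ + X →
        (1ℚ + S) * ((Ψ 0ℚ + T) - Ψ R) ≡ (1ℚ + S) + (((Ψ 0ℚ + T) - Ψ X) + S * (S + Ψ 0ℚ - Ψ R + T))
      identity X R≡1+X = linear-combination R≡1+X (R * R + ℕ→ℚ 4 * R + ℕ→ℚ 3 - X) (solve (R ∷ U ∷ X ∷ []) ℚ-ring)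

  -- Y stands for ℕ→ℚ y, as a variable for the ring solver.
  module ToPath {y : ℕ} (y<s : y ℕ.< s) (Y : ℚ) (y≡Y : ℕ→ℚ y ≡ Y) where

    private
      g : ℕ → ℚ
      g k = H k y

      h-Kb : ∀ {x} → x ℕ.< s → H (s ℕ.+ x) y ≡ S + Φ Y
      h-Kb x<s = trans (H-Kb-path x<s y<s) (cong (λ z → S + Φ z) y≡Y)

      h-Kc : ∀ {x} → x ℕ.< s → H (s ℕ.+ s ℕ.+ x) y ≡ S + Ψ Y - Ψ R
      h-Kc x<s = trans (H-Kc-path x<s y<s) (cong (λ z → S + Ψ z - Ψ R) y≡Y)

      h-below : ∀ {x} → x ℕ.< s → x ℕ.≤ y → H x y ≡ Φ Y - Φ (ℕ→ℚ x)
      h-below {x} x<s x≤y = trans (H-path-≤ x<s y<s x≤y) (cong (λ z → Φ z - Φ (ℕ→ℚ x)) y≡Y)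

      h-above : ∀ {x} → x ℕ.< s → y ℕ.≤ x → H x y ≡ Ψ Y - Ψ (ℕ→ℚ x)
      h-above {x} x<s y≤x = trans (H-path-≥ x<s y<s y≤x) (cong (λ z → Ψ z - Ψ (ℕ→ℚ x)) y≡Y)

      ∑Kb-g : ∑Kb g ≡ S * (S + Φ Y)
      ∑Kb-g = ∑Kb-uniform {g} _ h-Kb

      ∑Kc-g : ∑Kc g ≡ S * (S + Ψ Y - Ψ R)
      ∑Kc-g = ∑Kc-uniform {g} _ h-Kc

      g-r : g r ≡ Ψ Y - Ψ R
      g-r = trans (h-above r<s (ℕ.≤-pred y<s)) (cong (λ z → Ψ Y - Ψ z) r≡R)

    from-Kb : ∀ {x} → x ℕ.< s → HittingEquation (s ℕ.+ x) y
    from-Kb {x} x<s = hitting-equation (s ℕ.+ x) y (deg-Kb x<s) (h-Kb x<s)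
      (trans (adjSum-Kb x<s g) (cong₂ _-_ (cong₂ _+_ (h-below 0<s z≤n) ∑Kb-g) (h-Kb x<s)))
      identity
      where
      identity : Expanded λ S q W T Φ Ψ →
        S * (S + Φ Y) ≡ S + ((Φ Y - Φ (ℕ→ℚ 0)) + S * (S + Φ Y) - (S + Φ Y))
      identity = solve (R ∷ Y ∷ []) ℚ-ring

    from-Kc : ∀ {x} → x ℕ.< s → HittingEquation (s ℕ.+ s ℕ.+ x) y
    from-Kc {x} x<s = hitting-equation (s ℕ.+ s ℕ.+ x) y (deg-Kc x<s) (h-Kc x<s)
      (trans (adjSum-Kc x<s g) (cong₂ _-_ (cong₂ _+_ g-r ∑Kc-g) (h-Kc x<s)))
      identity
      where
      identity : Expanded λ S q W T Φ Ψ →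
        S * (S + Ψ Y - Ψ R) ≡ S + ((Ψ Y - Ψ R) + S * (S + Ψ Y - Ψ R) - (S + Ψ Y - Ψ R))
      identity = solve (R ∷ Y ∷ []) ℚ-ring

    from-path : ∀ {x} → x ℕ.< s → x ≢ y → HittingEquation x y
    from-path {x} u<s x≢y with ℕ.<-cmp x y | pathVertex u<s
    ... | tri≈ _ x≡y _ | _ = contradiction x≡y x≢y
    ... | tri< x<y _ _ | lone r≡0 = ⊥-elim (ℕ.<⇒≱ x<y (subst (y ℕ.≤_) r≡0 (ℕ.≤-pred y<s)))
    ... | tri< x<y _ _ | leftEnd 0<r = hitting-equation 0 y (deg-leftEnd 0<r) (h-below 0<s z≤n)
      (trans (adjSum-leftEnd 0<r g) (cong₂ _+_ (h-below (s≤s 0<r) x<y) ∑Kb-g))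
      identity
      where
      identity : Expanded λ S q W T Φ Ψ →
        (1ℚ + S) * (Φ Y - Φ (ℕ→ℚ 0)) ≡ (1ℚ + S) + ((Φ Y - Φ (ℕ→ℚ 1)) + S * (S + Φ Y))
      identity = solve (R ∷ Y ∷ []) ℚ-ring
    ... | tri< x<y _ _ | interior {x′} x+2<s = hitting-equation (suc x′) y (deg-interior x+2<s)
      (trans (h-below x+1<s (ℕ.<⇒≤ x<y)) (cong (λ z → Φ Y - Φ z) (ℕ→ℚ-suc x′)))
      (trans (adjSum-interior x+2<s g) (cong₂ _+_ (h-below x<s (ℕ.<⇒≤ (ℕ.<-trans (ℕ.n<1+n x′) x<y)))
        (trans (h-below x+2<s x<y) (cong (λ z → Φ Y - Φ z) (ℕ→ℚ-2+ x′)))))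
      (Φ-second-difference (Φ Y) (ℕ→ℚ x′))
      where
      x<s = proj₁ (interior<s x+2<s)
      x+1<s = proj₂ (interior<s x+2<s)
    ... | tri< x<y _ _ | rightEnd _ = ⊥-elim (ℕ.<⇒≱ x<y (ℕ.≤-pred y<s))
    ... | tri> _ _ y<x | lone _    = ⊥-elim (ℕ.n≮0 y<x)
    ... | tri> _ _ y<x | leftEnd _ = ⊥-elim (ℕ.n≮0 y<x)
    ... | tri> _ _ y<x | interior {x′} x+2<s = hitting-equation (suc x′) y (deg-interior x+2<s)
      (trans (h-above x+1<s (ℕ.<⇒≤ y<x)) (cong (λ z → Ψ Y - Ψ z) (ℕ→ℚ-suc x′)))
      (trans (adjSum-interior x+2<s g) (cong₂ _+_ (h-above x<s (ℕ.≤-pred y<x))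
        (trans (h-above x+2<s (ℕ.<⇒≤ (ℕ.<-trans y<x (ℕ.n<1+n (suc x′))))) (cong (λ z → Ψ Y - Ψ z) (ℕ→ℚ-2+ x′)))))
      (Ψ-second-difference (Ψ Y) (ℕ→ℚ x′))
      where
      x<s = proj₁ (interior<s x+2<s)
      x+1<s = proj₂ (interior<s x+2<s)
    ... | tri> _ _ y<x | rightEnd {x′} r≡x+1 = hitting-equation r y (deg-rightEnd r≡x+1) g-r
      (trans (adjSum-rightEnd r≡x+1 g)
        (cong₂ _+_ (h-above (rightEnd<s r≡x+1) (ℕ.≤-pred (subst (y ℕ.<_) r≡x+1 y<x))) ∑Kc-g))
      (identity (ℕ→ℚ x′) (R≡1+x r≡x+1))
      where
      identity : ∀ X → Expanded λ S q W T Φ Ψ → R ≡ 1ℚ + X →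
        (1ℚ + S) * (Ψ Y - Ψ R) ≡ (1ℚ + S) + ((Ψ Y - Ψ X) + S * (S + Ψ Y - Ψ R))
      identity X R≡1+X = linear-combination R≡1+X (R * R + ℕ→ℚ 4 * R + ℕ→ℚ 3 - X) (solve (R ∷ Y ∷ X ∷ []) ℚ-ring)

  module ToKc {y : ℕ} (y<s : y ℕ.< s) where

    private
      g : ℕ → ℚ
      g k = H k (s ℕ.+ s ℕ.+ y)

      ∑Kb-g : ∑Kb g ≡ S * (S + Φ R + T)
      ∑Kb-g = ∑Kb-uniform {g} _ (λ k<s → H-Kb-Kc k<s y<s)

      g-r : g r ≡ (Φ R + T) - Φ R
      g-r = trans (H-path-Kc r<s y<s) (cong (λ z → (Φ R + T) - Φ z) r≡R)

    from-Kb : ∀ {x} → x ℕ.< s → HittingEquation (s ℕ.+ x) (s ℕ.+ s ℕ.+ y)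
    from-Kb {x} x<s = hitting-equation (s ℕ.+ x) (s ℕ.+ s ℕ.+ y) (deg-Kb x<s) (H-Kb-Kc x<s y<s)
      (trans (adjSum-Kb x<s g) (cong₂ _-_ (cong₂ _+_ (H-path-Kc 0<s y<s) ∑Kb-g) (H-Kb-Kc x<s y<s)))
      identity
      where
      identity : Expanded λ S q W T Φ Ψ →
        S * (S + Φ R + T) ≡ S + (((Φ R + T) - Φ (ℕ→ℚ 0)) + S * (S + Φ R + T) - (S + Φ R + T))
      identity = solve (R ∷ U ∷ []) ℚ-ring

    from-Kc : ∀ {x} → x ℕ.< s → x ≢ y → HittingEquation (s ℕ.+ s ℕ.+ x) (s ℕ.+ s ℕ.+ y)
    from-Kc {x} x<s x≢y = hitting-equation (s ℕ.+ s ℕ.+ x) (s ℕ.+ s ℕ.+ y) (deg-Kc x<s) (H-Kc-≢ x<s y<s x≢y)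
      (trans (adjSum-Kc x<s g) (cong₂ _-_ (cong₂ _+_ g-r (∑Kc-clique y<s)) (H-Kc-≢ x<s y<s x≢y)))
      identity
      where
      identity : Expanded λ S q W T Φ Ψ → S * U ≡ S + (((Φ R + T) - Φ R) + U * R - U)
      identity = solve (R ∷ U ∷ []) ℚ-ring

    from-path : ∀ {x} → x ℕ.< s → HittingEquation x (s ℕ.+ s ℕ.+ y)
    from-path u<s with pathVertex u<s
    ... | lone r≡0 = hitting-equation 0 (s ℕ.+ s ℕ.+ y) (deg-lone r≡0) (H-path-Kc 0<s y<s)
      (trans (adjSum-lone r≡0 g) (cong₂ _+_ ∑Kb-g (∑Kc-clique y<s)))
      (identity (R≡0 r≡0))
      where
      identity : Expanded λ S q W T Φ Ψ → R ≡ 0ℚ →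
        (S + S) * ((Φ R + T) - Φ (ℕ→ℚ 0)) ≡ (S + S) + (S * (S + Φ R + T) + U * R)
      identity R≡0 = linear-combination U[S+1]≡W 1ℚ
        (linear-combination R≡0 (R * R * R + ℕ→ℚ 5 * R * R + ℕ→ℚ 6 * R + ℕ→ℚ 4) (solve (R ∷ U ∷ []) ℚ-ring))
    ... | leftEnd 0<r = hitting-equation 0 (s ℕ.+ s ℕ.+ y) (deg-leftEnd 0<r) (H-path-Kc 0<s y<s)
      (trans (adjSum-leftEnd 0<r g) (cong₂ _+_ (H-path-Kc (s≤s 0<r) y<s) ∑Kb-g))
      identity
      where
      identity : Expanded λ S q W T Φ Ψ →
        (1ℚ + S) * ((Φ R + T) - Φ (ℕ→ℚ 0)) ≡ (1ℚ + S) + (((Φ R + T) - Φ (ℕ→ℚ 1)) + S * (S + Φ R + T))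
      identity = solve (R ∷ U ∷ []) ℚ-ring
    ... | interior {x} x+2<s = hitting-equation (suc x) (s ℕ.+ s ℕ.+ y) (deg-interior x+2<s)
      (trans (H-path-Kc x+1<s y<s) (cong (λ z → (Φ R + T) - Φ z) (ℕ→ℚ-suc x)))
      (trans (adjSum-interior x+2<s g) (cong₂ _+_ (H-path-Kc x<s y<s)
        (trans (H-path-Kc x+2<s y<s) (cong (λ z → (Φ R + T) - Φ z) (ℕ→ℚ-2+ x)))))
      (Φ-second-difference (Φ R + T) (ℕ→ℚ x))
      where
      x<s = proj₁ (interior<s x+2<s)
      x+1<s = proj₂ (interior<s x+2<s)
    ... | rightEnd {x} r≡x+1 = hitting-equation r (s ℕ.+ s ℕ.+ y) (deg-rightEnd r≡x+1) g-r
      (trans (adjSum-rightEnd r≡x+1 g) (cong₂ _+_ (H-path-Kc (rightEnd<s r≡x+1) y<s) (∑Kc-clique y<s)))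
      (identity (ℕ→ℚ x) (R≡1+x r≡x+1))
      where
      identity : ∀ X → Expanded λ S q W T Φ Ψ → R ≡ 1ℚ + X →
        (1ℚ + S) * ((Φ R + T) - Φ R) ≡ (1ℚ + S) + (((Φ R + T) - Φ X) + U * R)
      identity X R≡1+X = linear-combination U[S+1]≡W 1ℚ
        (linear-combination R≡1+X (- (R * R + ℕ→ℚ 4 * R + ℕ→ℚ 1 + X)) (solve (R ∷ U ∷ X ∷ []) ℚ-ring))

  ReturnEquation : ℕ → Set
  ReturnEquation u = deg u + adjSum u (λ k → H k u) ≡ W

  return-equation : ∀ u {d n} → deg u ≡ d → adjSum u (λ k → H k u) ≡ n → d + n ≡ W → ReturnEquation u
  return-equation _ refl refl d+n≡W = d+n≡W

  return-Kb : ∀ {x} → x ℕ.< s → ReturnEquation (s ℕ.+ x)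
  return-Kb {x} x<s = return-equation (s ℕ.+ x) (deg-Kb x<s)
    (trans (adjSum-Kb x<s (λ k → H k (s ℕ.+ x))) (cong₂ _-_ (cong₂ _+_ (H-path-Kb 0<s x<s) (∑Kb-clique x<s)) (H-Kb-diag x<s)))
    identity
    where
    identity : Expanded λ S q W T Φ Ψ → S + (((Ψ 0ℚ + T) - Ψ (ℕ→ℚ 0)) + U * R - 0ℚ) ≡ W
    identity = linear-combination U[S+1]≡W 1ℚ (solve (R ∷ U ∷ []) ℚ-ring)

  return-Kc : ∀ {x} → x ℕ.< s → ReturnEquation (s ℕ.+ s ℕ.+ x)
  return-Kc {x} x<s = return-equation (s ℕ.+ s ℕ.+ x) (deg-Kc x<s)
    (trans (adjSum-Kc x<s (λ k → H k (s ℕ.+ s ℕ.+ x))) (cong₂ _-_ (cong₂ _+_ g-r (∑Kc-clique x<s)) (H-Kc-diag x<s)))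
    identity
    where
    identity : Expanded λ S q W T Φ Ψ → S + (((Φ R + T) - Φ R) + U * R - 0ℚ) ≡ W
    identity = linear-combination U[S+1]≡W 1ℚ (solve (R ∷ U ∷ []) ℚ-ring)
    g-r : H r (s ℕ.+ s ℕ.+ x) ≡ (Φ R + T) - Φ R
    g-r = trans (H-path-Kc r<s x<s) (cong (λ z → (Φ R + T) - Φ z) r≡R)

  return-path : ∀ {x} → x ℕ.< s → ReturnEquation x
  return-path u<s with pathVertex u<s
  ... | lone r≡0 = return-equation 0 (deg-lone r≡0)
    (trans (adjSum-lone r≡0 (λ k → H k 0)) (cong₂ _+_ (∑Kb-uniform {λ k → H k 0} _ (λ k<s → H-Kb-path k<s 0<s))
                                                  (∑Kc-uniform {λ k → H k 0} _ (λ k<s → H-Kc-path k<s 0<s))))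
    (identity (R≡0 r≡0))
    where
    identity : Expanded λ S q W T Φ Ψ → R ≡ 0ℚ → (S + S) + (S * (S + Φ (ℕ→ℚ 0)) + S * (S + Ψ (ℕ→ℚ 0) - Ψ R)) ≡ W
    identity R≡0 = linear-combination R≡0 (R * R * R + ℕ→ℚ 5 * R * R + ℕ→ℚ 6 * R) (solve (R ∷ []) ℚ-ring)
  ... | leftEnd 0<r = return-equation 0 (deg-leftEnd 0<r)
    (trans (adjSum-leftEnd 0<r (λ k → H k 0))
      (cong₂ _+_ (H-path-≥ (s≤s 0<r) 0<s z≤n) (∑Kb-uniform {λ k → H k 0} _ (λ k<s → H-Kb-path k<s 0<s))))
    identity
    where
    identity : Expanded λ S q W T Φ Ψ → (1ℚ + S) + ((Ψ (ℕ→ℚ 0) - Ψ (ℕ→ℚ 1)) + S * (S + Φ (ℕ→ℚ 0))) ≡ W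
    identity = solve (R ∷ []) ℚ-ring
  ... | interior {x} x+2<s = return-equation (suc x) (deg-interior x+2<s)
    (trans (adjSum-interior x+2<s (λ k → H k (suc x))) (cong₂ _+_
      (trans (H-path-≤ x<s x+1<s (ℕ.n≤1+n x)) (cong (λ z → Φ z - Φ (ℕ→ℚ x)) (ℕ→ℚ-suc x)))
      (trans (H-path-≥ x+2<s x+1<s (ℕ.n≤1+n (suc x))) (cong₂ (λ z z′ → Ψ z - Ψ z′) (ℕ→ℚ-suc x) (ℕ→ℚ-2+ x)))))
    (identity (ℕ→ℚ x))
    where
    x<s = proj₁ (interior<s x+2<s)
    x+1<s = proj₂ (interior<s x+2<s)
    identity : ∀ X → Expanded λ S q W T Φ Ψ → (1ℚ + 1ℚ) + ((Φ (1ℚ + X) - Φ X) + (Ψ (1ℚ + X) - Ψ (1ℚ + (1ℚ + X)))) ≡ W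
    identity X = solve (R ∷ X ∷ []) ℚ-ring
  ... | rightEnd {x} r≡x+1 = return-equation r (deg-rightEnd r≡x+1)
    (trans (adjSum-rightEnd r≡x+1 (λ k → H k r)) (cong₂ _+_
      (trans (H-path-≤ (rightEnd<s r≡x+1) r<s (ℕ.≤-trans (ℕ.n≤1+n x) (ℕ.≤-reflexive (sym r≡x+1))))
             (cong (λ z → Φ z - Φ (ℕ→ℚ x)) r≡R))
      (∑Kc-uniform {λ k → H k r} _ (λ k<s → trans (H-Kc-path k<s r<s) (cong (λ z → S + Ψ z - Ψ R) r≡R)))))
    (identity (ℕ→ℚ x) (R≡1+x r≡x+1))
    where
    identity : ∀ X → Expanded λ S q W T Φ Ψ → R ≡ 1ℚ + X → (1ℚ + S) + ((Φ R - Φ X) + S * (S + Ψ R - Ψ R)) ≡ W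
    identity X R≡1+X = linear-combination R≡1+X (R * R + ℕ→ℚ 4 * R + ℕ→ℚ 1 + X) (solve (R ∷ X ∷ []) ℚ-ring)

  hitting-equations : ∀ {u v} → Vertex u → Vertex v → u ≢ v → HittingEquation u v
  hitting-equations (inKb x<s) (inKb y<s) u≢v = ToKb.from-Kb y<s x<s (u≢v ∘ cong (s ℕ.+_))
  hitting-equations (inKc x<s) (inKb y<s) _   = ToKb.from-Kc y<s x<s
  hitting-equations (path x<s) (inKb y<s) _   = ToKb.from-path y<s x<s
  hitting-equations (inKb x<s) (path y<s) _   = ToPath.from-Kb y<s _ refl x<s
  hitting-equations (inKc x<s) (path y<s) _   = ToPath.from-Kc y<s _ refl x<s
  hitting-equations (path x<s) (path y<s) u≢v = ToPath.from-path y<s _ refl x<s u≢v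
  hitting-equations (inKb x<s) (inKc y<s) _   = ToKc.from-Kb y<s x<s
  hitting-equations (inKc x<s) (inKc y<s) u≢v = ToKc.from-Kc y<s x<s (u≢v ∘ cong ((s ℕ.+ s) ℕ.+_))
  hitting-equations (path x<s) (inKc y<s) _   = ToKc.from-path y<s x<s

  return-equations : ∀ {u} → Vertex u → ReturnEquation u
  return-equations (path x<s) = return-path x<s
  return-equations (inKb x<s) = return-Kb x<s
  return-equations (inKc x<s) = return-Kc x<s

  H-diagonal : ∀ {u} → Vertex u → H u u ≡ 0ℚ
  H-diagonal (path x<s) = H-path-diag x<s
  H-diagonal (inKb x<s) = H-Kb-diag x<s
  H-diagonal (inKc x<s) = H-Kc-diag x<s

  deg-path : ∀ {x} → x ℕ.< s → deg x ≡ ℕ→ℚ 2 + R * (b2q (x ≡ᵇ 0) + b2q (x ≡ᵇ r))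
  deg-path u<s with pathVertex u<s
  ... | lone r≡0 = begin
    deg 0                                      ≡⟨ deg-lone r≡0 ⟩
    S + S                                      ≡⟨ identity ⟩
    ℕ→ℚ 2 + R * (1ℚ + 1ℚ)                      ≡⟨ cong (λ t → ℕ→ℚ 2 + R * (1ℚ + b2q (0 ≡ᵇ t))) r≡0 ⟨
    ℕ→ℚ 2 + R * (1ℚ + b2q (0 ≡ᵇ r))            ∎
    where
    open ≡-Reasoning
    identity : Expanded λ S _ _ _ _ _ → S + S ≡ ℕ→ℚ 2 + R * (1ℚ + 1ℚ)
    identity = solve (R ∷ []) ℚ-ring
  ... | leftEnd 0<r = begin
    deg 0                                      ≡⟨ deg-leftEnd 0<r ⟩
    1ℚ + S                                     ≡⟨ identity ⟩
    ℕ→ℚ 2 + R * (1ℚ + 0ℚ)                      ≡⟨ cong (λ b → ℕ→ℚ 2 + R * (1ℚ + b2q b)) (≡ᵇ-false (ℕ.<⇒≢ 0<r)) ⟨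
    ℕ→ℚ 2 + R * (1ℚ + b2q (0 ≡ᵇ r))            ∎
    where
    open ≡-Reasoning
    identity : Expanded λ S _ _ _ _ _ → 1ℚ + S ≡ ℕ→ℚ 2 + R * (1ℚ + 0ℚ)
    identity = solve (R ∷ []) ℚ-ring
  ... | interior {x} x+2<s = begin
    deg (suc x)                                ≡⟨ deg-interior x+2<s ⟩
    1ℚ + 1ℚ                                    ≡⟨ solve (R ∷ []) ℚ-ring ⟩
    ℕ→ℚ 2 + R * (0ℚ + 0ℚ)                      ≡⟨ cong (λ b → ℕ→ℚ 2 + R * (0ℚ + b2q b)) (≡ᵇ-false (ℕ.<⇒≢ (ℕ.≤-pred x+2<s))) ⟨
    ℕ→ℚ 2 + R * (0ℚ + b2q (suc x ≡ᵇ r))        ∎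
    where open ≡-Reasoning
  ... | rightEnd {x} r≡x+1 = begin
    deg r                                      ≡⟨ deg-rightEnd r≡x+1 ⟩
    1ℚ + S                                     ≡⟨ identity ⟩
    ℕ→ℚ 2 + R * (0ℚ + 1ℚ)                      ≡⟨ cong₂ (λ b c → ℕ→ℚ 2 + R * (b2q b + b2q c)) (cong (_≡ᵇ 0) r≡x+1) (≡ᵇ-refl r) ⟨
    ℕ→ℚ 2 + R * (b2q (r ≡ᵇ 0) + b2q (r ≡ᵇ r))  ∎
    where
    open ≡-Reasoning
    identity : Expanded λ S _ _ _ _ _ → 1ℚ + S ≡ ℕ→ℚ 2 + R * (0ℚ + 1ℚ)
    identity = solve (R ∷ []) ℚ-ring

  ∑path-deg : ∀ f → sumℕ s (λ x → deg x * f x) ≡ ℕ→ℚ 2 * sumℕ s f + R * (f 0 + f r)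
  ∑path-deg f = begin
    sumℕ s (λ x → deg x * f x)
      ≡⟨ sumℕ-cong s (λ {x} x<s → trans (cong (_* f x) (deg-path x<s)) (distribute (b2q (x ≡ᵇ 0)) (b2q (x ≡ᵇ r)) (f x))) ⟩
    sumℕ s (λ x → ℕ→ℚ 2 * f x + R * (at-0 x + at-r x))
      ≡⟨ ∑-distrib-+ {s} (λ x → ℕ→ℚ 2 * f (Fin.toℕ x)) (λ x → R * (at-0 (Fin.toℕ x) + at-r (Fin.toℕ x))) ⟩
    sumℕ s (λ x → ℕ→ℚ 2 * f x) + sumℕ s (λ x → R * (at-0 x + at-r x))
      ≡⟨ cong₂ _+_ (sym (*-distribˡ-sum {s} (ℕ→ℚ 2) (f ∘ Fin.toℕ)))
                   (sym (*-distribˡ-sum {s} R (λ x → at-0 (Fin.toℕ x) + at-r (Fin.toℕ x)))) ⟩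
    ℕ→ℚ 2 * sumℕ s f + R * sumℕ s (λ x → at-0 x + at-r x)
      ≡⟨ cong (λ z → ℕ→ℚ 2 * sumℕ s f + R * z) (trans (∑-distrib-+ {s} (at-0 ∘ Fin.toℕ) (at-r ∘ Fin.toℕ))
                                                     (cong₂ _+_ (sumℕ-delta {s} {0} f 0<s) (sumℕ-delta {s} {r} f r<s))) ⟩
    ℕ→ℚ 2 * sumℕ s f + R * (f 0 + f r)
      ∎
    where
    open ≡-Reasoning
    at-0 at-r : ℕ → ℚ
    at-0 x = b2q (x ≡ᵇ 0) * f x
    at-r x = b2q (x ≡ᵇ r) * f x
    distribute : ∀ a b F → (ℕ→ℚ 2 + R * (a + b)) * F ≡ ℕ→ℚ 2 * F + R * (a * F + b * F)
    distribute a b F = solve (R ∷ a ∷ b ∷ F ∷ []) ℚ-ring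

  ∑deg≡W : sumℕ N deg ≡ W
  ∑deg≡W = begin
    sumℕ N deg                                          ≡⟨ sumℕ-N deg ⟩
    (sumℕ s deg + ∑Kb deg) + ∑Kc deg                    ≡⟨ cong₂ _+_ (cong₂ _+_ path-part (∑Kb-uniform {deg} S deg-Kb)) (∑Kc-uniform {deg} S deg-Kc) ⟩
    (ℕ→ℚ 2 * (S * 1ℚ) + R * (1ℚ + 1ℚ) + S * S) + S * S  ≡⟨ identity ⟩
    W                                                   ∎
    where
    open ≡-Reasoning
    identity : Expanded λ S _ W _ _ _ → (ℕ→ℚ 2 * (S * 1ℚ) + R * (1ℚ + 1ℚ) + S * S) + S * S ≡ W
    identity = solve (R ∷ []) ℚ-ring
    path-part : sumℕ s deg ≡ ℕ→ℚ 2 * (S * 1ℚ) + R * (1ℚ + 1ℚ)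
    path-part = trans (sumℕ-cong s (λ {x} _ → sym (ℚ.*-identityʳ (deg x))))
      (trans (∑path-deg (λ _ → 1ℚ)) (cong (λ z → ℕ→ℚ 2 * z + R * (1ℚ + 1ℚ)) (trans (sumℕ-const s 1ℚ) (cong (_* 1ℚ) s≡S))))

  open RandomWalk A
    using (neighbourSum; ReturnTimes; isHittingTimes-intro; connected⇒degree≢0; twiceEdges≢0;
           kemenyFrom≡; kemenyConstantIs-intro)

  M : Fin N → Fin N → ℚ
  M i j = H (Fin.toℕ i) (Fin.toℕ j)

  vertexOf : ∀ i → Vertex (Fin.toℕ i)
  vertexOf i = vertex (Fin.toℕ<n i)

  Kb₀ : Fin N
  Kb₀ = ⟨ Kb<N 0<s ⟩

  degree≢0 : ∀ i → degree A i ≢ 0ℚ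
  degree≢0 = connected⇒degree≢0 connected Kb₀≢path₀
    where
    Kb₀≢path₀ : Kb₀ ≢ ⟨ path<N 0<s ⟩
    Kb₀≢path₀ eq = ℕ.1+n≢0 (trans (sym (Fin.toℕ-fromℕ< (Kb<N 0<s)))
                                  (trans (cong Fin.toℕ eq) (Fin.toℕ-fromℕ< (path<N 0<s))))

  twiceEdges≡W : twiceEdges A ≡ W
  twiceEdges≡W = trans twiceEdges≡∑deg ∑deg≡W

  W≢0 : W ≢ 0ℚ
  W≢0 W≡0 = twiceEdges≢0 {Kb₀} (degree≢0 Kb₀) (trans twiceEdges≡W W≡0)

  isHittingTimes : IsHittingTimes A M
  isHittingTimes = isHittingTimes-intro degree≢0 (λ j → H-diagonal (vertexOf j)) λ i j i≢j →
    subst (λ d → d * M i j ≡ d + neighbourSum i (λ k → M k j)) (sym (degree≡deg i))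
          (hitting-equations (vertexOf i) (vertexOf j) (i≢j ∘ Fin.toℕ-injective))

  returnTimes : ReturnTimes M
  returnTimes i = subst₂ (λ d w → d + neighbourSum i (λ k → M k i) ≡ w) (sym (degree≡deg i)) (sym twiceEdges≡W)
                         (return-equations (vertexOf i))

  ΣY ΣY² : ℚ
  ΣY  = sumℕ s ℕ→ℚ
  ΣY² = sumℕ s (λ y → ℕ→ℚ y * ℕ→ℚ y)

  kemeny-total : sumℕ N (λ j → deg j * H (s ℕ.+ 0) j) ≡
    ((ℕ→ℚ 2 * (S * S + (ΣY * q + ΣY²)) + R * ((S + Φ (ℕ→ℚ 0)) + (S + Φ R))) + S * (U * R)) + S * (S * (S + Φ R + T))
  kemeny-total = trans (sumℕ-N (λ j → deg j * H (s ℕ.+ 0) j)) (cong₂ _+_ (cong₂ _+_ path-part Kb-part) Kc-part)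
    where
    f : ℕ → ℚ
    f y = S + Φ (ℕ→ℚ y)
    ∑f : sumℕ s f ≡ S * S + (ΣY * q + ΣY²)
    ∑f = trans (∑-distrib-+ {s} (λ _ → S) (λ y → ℕ→ℚ (Fin.toℕ y) * q + ℕ→ℚ (Fin.toℕ y) * ℕ→ℚ (Fin.toℕ y)))
           (cong₂ _+_ (trans (sumℕ-const s S) (cong (_* S) s≡S))
             (trans (∑-distrib-+ {s} (λ y → ℕ→ℚ (Fin.toℕ y) * q) (λ y → ℕ→ℚ (Fin.toℕ y) * ℕ→ℚ (Fin.toℕ y)))
                    (cong (_+ ΣY²) (sym (*-distribʳ-sum {s} q (ℕ→ℚ ∘ Fin.toℕ))))))
    path-part = trans (sumℕ-cong s (λ {y} y<s → cong (deg y *_) (H-Kb-path 0<s y<s)))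
      (trans (∑path-deg f) (cong₂ (λ a b → ℕ→ℚ 2 * a + R * (f 0 + (S + Φ b))) ∑f r≡R))
    Kb-part = trans (sumℕ-cong s (λ {k} k<s → cong₂ _*_ (deg-Kb k<s)
                      (trans (H-Kb-Kb 0<s k<s) (cong (λ b → if b then 0ℚ else U) (≡ᵇ-sym 0 k)))))
      (trans (sym (*-distribˡ-sum {s} S (λ k → if Fin.toℕ k ≡ᵇ 0 then 0ℚ else U))) (cong (S *_) (clique-sum 0<s)))
    Kc-part = ∑Kc-uniform {λ j → deg j * H (s ℕ.+ 0) j} _ (λ k<s → cong₂ _*_ (deg-Kc k<s) (H-Kb-Kc 0<s k<s))

  kemeny-value : ∀ n → n ≡ ℕ→ℚ 3 * S → sumℕ N (λ j → deg j * H (s ℕ.+ 0) j) ÷₀ W ≡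
    (ℕ→ℚ 1 ÷₀ ℕ→ℚ 54) *
      ((n * n * n + ℕ→ℚ 3 * n * n + ℕ→ℚ 24 * n - ℕ→ℚ 36)
      + ((- (ℕ→ℚ 513 * n * n) + ℕ→ℚ 1782 * n - ℕ→ℚ 1701) ÷₀ (n * n * n + ℕ→ℚ 9 * n * n + ℕ→ℚ 9 * n - ℕ→ℚ 27)))
  kemeny-value n refl = trans (cong (_÷₀ W) kemeny-total) (÷₀-rearrange {p = polynomial} {q = remainder} W≢0 (ℕ→ℚ-suc≢0 53) D≢0
    (identity ΣY ΣY² (trans (sumℕ-id s) (cong (λ z → z * (z - 1ℚ)) s≡S))
                     (trans (sumℕ-square s) (cong (λ z → (z - 1ℚ) * z * (ℕ→ℚ 2 * z - 1ℚ)) s≡S))))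
    where
    polynomial remainder : ℚ
    polynomial = n * n * n + ℕ→ℚ 3 * n * n + ℕ→ℚ 24 * n - ℕ→ℚ 36
    remainder  = - (ℕ→ℚ 513 * n * n) + ℕ→ℚ 1782 * n - ℕ→ℚ 1701
    W≡2E : Expanded λ S _ W _ _ _ → W ≡ ℕ→ℚ 2 * (S * S + ℕ→ℚ 2 * S - 1ℚ)
    W≡2E = solve (R ∷ []) ℚ-ring
    D≡27[S+1]E : Expanded λ S _ _ _ _ _ → let n = ℕ→ℚ 3 * S in
      n * n * n + ℕ→ℚ 9 * n * n + ℕ→ℚ 9 * n - ℕ→ℚ 27 ≡ ℕ→ℚ 27 * ((S + 1ℚ) * (S * S + ℕ→ℚ 2 * S - 1ℚ))
    D≡27[S+1]E = solve (R ∷ []) ℚ-ring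
    S+1≢0 : S + 1ℚ ≢ 0ℚ
    S+1≢0 = subst (λ z → (1ℚ + z) + 1ℚ ≢ 0ℚ) r≡R (1+r+1≢0 r)
    E≢0 : S * S + ℕ→ℚ 2 * S - 1ℚ ≢ 0ℚ
    E≢0 E≡0 = W≢0 (trans W≡2E (trans (cong (ℕ→ℚ 2 *_) E≡0) (ℚ.*-zeroʳ (ℕ→ℚ 2))))
    D≢0 : n * n * n + ℕ→ℚ 9 * n * n + ℕ→ℚ 9 * n - ℕ→ℚ 27 ≢ 0ℚ
    D≢0 D≡0 = *-≢0 (ℕ→ℚ-suc≢0 26) (*-≢0 S+1≢0 E≢0) (trans (sym D≡27[S+1]E) D≡0)
    identity : ∀ σ σ² → Expanded λ S q W T Φ Ψ →
      ℕ→ℚ 2 * σ ≡ S * (S - 1ℚ) → ℕ→ℚ 6 * σ² ≡ (S - 1ℚ) * S * (ℕ→ℚ 2 * S - 1ℚ) →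
      let n = ℕ→ℚ 3 * S
          D = n * n * n + ℕ→ℚ 9 * n * n + ℕ→ℚ 9 * n - ℕ→ℚ 27
      in (((ℕ→ℚ 2 * (S * S + (σ * q + σ²)) + R * ((S + Φ (ℕ→ℚ 0)) + (S + Φ R))) + S * (U * R)) + S * (S * (S + Φ R + T)))
           * (ℕ→ℚ 54 * D)
         ≡ ((n * n * n + ℕ→ℚ 3 * n * n + ℕ→ℚ 24 * n - ℕ→ℚ 36) * D + (- (ℕ→ℚ 513 * n * n) + ℕ→ℚ 1782 * n - ℕ→ℚ 1701)) * W
    identity σ σ² 2σ≡S[S-1] 6σ²≡[S-1]S[2S-1] =
      let S = 1ℚ + R
          E = S * S + ℕ→ℚ 2 * S - 1ℚ
          D = ℕ→ℚ 27 * (S + 1ℚ) * E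
      in linear-combination U[S+1]≡W (ℕ→ℚ 1458 * S * (ℕ→ℚ 3 * S - 1ℚ) * E)
           (linear-combination 2σ≡S[S-1] (ℕ→ℚ 54 * (S * (S + 1ℚ)) * D)
             (linear-combination 6σ²≡[S-1]S[2S-1] (ℕ→ℚ 18 * D) (solve (R ∷ U ∷ σ ∷ σ² ∷ []) ℚ-ring)))

  kemenyConstant : KemenyConstantIs A (corollary3p5-rhs (s ℕ.* 3))
  kemenyConstant = kemenyConstantIs-intro connected degree≢0 (twiceEdges≢0 {Kb₀} (degree≢0 Kb₀))
                                          isHittingTimes returnTimes Kb₀ value
    where
    open ≡-Reasoning
    total : ∑[ j < N ] (degree A j * M Kb₀ j) ≡ sumℕ N (λ j → deg j * H (s ℕ.+ 0) j)
    total = sum-cong-≗ {N} (λ j → cong₂ _*_ (degree≡deg j)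
                                     (cong (λ u → H u (Fin.toℕ j)) (Fin.toℕ-fromℕ< (Kb<N 0<s))))
    n≡3S : ℕ→ℚ (s ℕ.* 3) ≡ ℕ→ℚ 3 * S
    n≡3S = trans (ℕ→ℚ-* s 3) (trans (ℚ.*-comm (ℕ→ℚ s) (ℕ→ℚ 3)) (cong (ℕ→ℚ 3 *_) s≡S))
    value : kemenyFrom A M Kb₀ ≡ corollary3p5-rhs (s ℕ.* 3)
    value = begin
      kemenyFrom A M Kb₀                                       ≡⟨ kemenyFrom≡ M Kb₀ ⟩
      (∑[ j < N ] (degree A j * M Kb₀ j)) ÷₀ twiceEdges A      ≡⟨ cong₂ _÷₀_ total twiceEdges≡W ⟩
      sumℕ N (λ j → deg j * H (s ℕ.+ 0) j) ÷₀ W                ≡⟨ kemeny-value (ℕ→ℚ (s ℕ.* 3)) n≡3S ⟩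
      corollary3p5-rhs (s ℕ.* 3)                               ∎

-- The hole is 2m, fixed by the type of the last argument, so that U = 2m / (S + 1).
barbell-kemeny : ∀ r → KemenyConstantIs (barbell (suc r) (suc r) (suc r)) (corollary3p5-rhs (suc r ℕ.* 3))
barbell-kemeny r = BarbellHitting.kemenyConstant r (ℕ→ℚ r) (_ ÷₀ ((1ℚ + ℕ→ℚ r) + 1ℚ)) refl
                                                 (÷₀-*-cancel _ (1+r+1≢0 r))

corollary3p5 : (n : ℕ) → 0 < n → 3 ∣ n →
    KemenyConstantIs (barbell (n / 3) (n / 3) (n / 3)) (corollary3p5-rhs n)
corollary3p5 .(0 ℕ.* 3)     ()  (divides zero refl)
corollary3p5 .(suc r ℕ.* 3) _  (divides (suc r) refl) =
  subst (λ k → KemenyConstantIs (barbell k k k) (corollary3p5-rhs (suc r ℕ.* 3)))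
        (sym (m*n/n≡m (suc r) 3)) (barbell-kemeny r)
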